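{- Let $P$ be a max-locked ordered set of width $w\ge3$. If $w\ne4$, let $k$ be such that $\alpha(R_k)\ge(w-1)!$; if $w=4$, let $k$ be such that $\alpha(R_k)>8$. Then: (1) if $R_k$ contains a non-maximal element, then no two elements of $R_k$ have equal sets of upper covers; (2) if $R_k$ contains a non-minimal element, then no two elements of $R_k$ have equal sets of lower covers.
   Context: Ordered sets are finite; width = largest antichain size; $\mathrm{Aut}(P)$ = automorphism group. Rank: minimal elements have rank $0$; $x$ has rank $k$ iff minimal in $P\setminus\{z:\mathrm{rank}(z)\le k-1\}$; $R_k$ = set of elements of rank $k$; $\alpha(R_k)$ = number of distinct restrictions $\Phi|_{R_k}$, $\Phi\in\mathrm{Aut}(P)$. $P$ is coconnected iff there is no partition $P=B\cup T$ into nonempty sets with $b<t$ for all $b\in B,t\in T$. A coconnected ordered set $P$ of width $w$ in which no element is fixed by all automorphisms is max-locked iff either $w\ge3$, $w\ne4$ and $\alpha(R_k)\ge(w-1)!$ for some $k$, or $w=4$ and $\alpha(R_k)>8$ for some $k$ (coconnected ordered sets of width 2 with exactly 2 automorphisms are also called max-locked). -}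

module Defs where

open import Level using (0ℓ)
open import Data.Nat using (ℕ; zero; suc; _≤_; _<_; _∸_; _!)

open import Data.Fin using (Fin)
open import Data.Fin.Subset using (Subset; _∈_; _∉_; ∣_∣)
open import Data.Product using (Σ; ∃; ∃-syntax; _×_; _,_)
open import Data.Sum using (_⊎_)
open import Data.Empty using (⊥)
open import Relation.Nullary using (¬_)
open import Relation.Binary using (Rel; IsPartialOrder)
open import Relation.Binary.PropositionalEquality using (_≡_; _≢_)

record FinPoset : Set₁ where
  field
    n      : ℕ
    _⊑_    : Rel (Fin n) 0ℓ
    isPO   : IsPartialOrder _≡_ _⊑_

module _ (P : FinPoset) where
  open FinPoset P

  _⊏_ : Fin n → Fin n → Set
  x ⊏ y = x ⊑ y × x ≢ y

  _⋖_ : Fin n → Fin n → Set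
  x ⋖ y = x ⊏ y × ¬ (∃[ u ] (x ⊏ u × u ⊏ y))

  IsAntichain : Subset n → Set
  IsAntichain A = ∀ x y → x ∈ A → y ∈ A → x ⊑ y → x ≡ y

  Width : ℕ → Set
  Width w = (∃[ A ] (IsAntichain A × ∣ A ∣ ≡ w))
          × (∀ A → IsAntichain A → ∣ A ∣ ≤ w)

  record Aut : Set where
    field
      to      : Fin n → Fin n
      from    : Fin n → Fin n
      to-from : ∀ x → to (from x) ≡ x
      from-to : ∀ x → from (to x) ≡ x
      preserve : ∀ x y → x ⊑ y → to x ⊑ to y
      reflect  : ∀ x y → to x ⊑ to y → x ⊑ y

  -- Rank (as in the paper):
  --   Below k x  :  x has rank ≤ k-1  (i.e. rank j for some j < k)
  --   Rank k x   :  x is minimal in P ∖ {z : rank z ≤ k-1}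
  mutual
    Below : ℕ → Fin n → Set
    Below zero    x = ⊥
    Below (suc k) x = Below k x ⊎ Rank k x

    Rank : ℕ → Fin n → Set
    Rank k x = ¬ Below k x × (∀ z → z ⊏ x → Below k z)

  RestrDiffer : ℕ → Aut → Aut → Set
  RestrDiffer k Φ Ψ = ∃[ x ] (Rank k x × Aut.to Φ x ≢ Aut.to Ψ x)

  -- α(R_k) ≥ m : there are m automorphisms with pairwise distinct
  -- restrictions to R_k
  AlphaAtLeast : ℕ → ℕ → Set
  AlphaAtLeast k m = Σ (Fin m → Aut) λ Φs →
    ∀ i j → i ≢ j → RestrDiffer k (Φs i) (Φs j)

  Coconnected : Set
  Coconnected = ¬ (Σ (Subset n) λ B →
      (∃[ b ] b ∈ B) × (∃[ t ] t ∉ B) × (∀ b t → b ∈ B → t ∉ B → b ⊏ t))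

  NoCommonFixedPoint : Set
  NoCommonFixedPoint = ∀ x → ∃[ Φ ] (Aut.to Φ x ≢ x)

  LockRank : ℕ → ℕ → Set
  LockRank w k = (w ≢ 4 → AlphaAtLeast k ((w ∸ 1) !))
               × (w ≡ 4 → AlphaAtLeast k 9)

  Maximal : Fin n → Set
  Maximal x = ¬ (∃[ y ] x ⊏ y)

  Minimal : Fin n → Set
  Minimal x = ¬ (∃[ y ] y ⊏ x)

  SameUpperCovers : Fin n → Fin n → Set
  SameUpperCovers x y = ∀ z → (x ⋖ z → y ⋖ z) × (y ⋖ z → x ⋖ z)

  SameLowerCovers : Fin n → Fin n → Set
  SameLowerCovers x y = ∀ z → (z ⋖ x → z ⋖ y) × (z ⋖ y → z ⋖ x)

{-# OPTIONS --safe #-}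
-- The relation "same upper covers" is an equivalence on R_k preserved by every automorphism.
-- If it has a class with two points, it leaves too few permutations of R_k: counting the
-- possible images point by point along a suitable listing of R_k (a largest class first, or the
-- classes pair by pair when all classes are pairs) gives fewer than (w-1)! (or 9 when w = 4)
-- unless the relation is total, and a unique singleton class would be a common fixed point.
-- So all of R_k share their upper covers, and α(R_k) <= |R_k|! forces |R_k| >= w-1. Then the
-- points incomparable to all of R_k form a nonempty chain (by coconnectedness and the width)
-- which every automorphism maps to itself, so its least point is a common fixed point.
-- Lower covers are handled by passing to the dual order.
module Submission where

open import Defs
open import Data.Nat using (ℕ; _≤_)
open import Data.Fin using (Fin)
open import Data.Product using (∃-syntax; _×_; _,_)
open import Function using (_∘_; flip)
open import Relation.Binary.PropositionalEquality using (_≡_; sym)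
open import Relation.Nullary using (¬_)
open import Relation.Unary using (Pred; Decidable)
open import Level using (0ℓ)

module Counting where

  open import Data.Bool using (if_then_else_)
  open import Data.Empty using (⊥-elim)
  open import Data.Fin using (Fin; zero; suc; _≟_)
  open import Data.Fin.Properties using (suc-injective)
  open import Data.Fin.Subset using (Subset; ∣_∣) renaming (_∈_ to _∈ₛ_)
  open import Data.List using (List; []; _∷_; length; filter; allFin)
  open import Data.List.Membership.Propositional using (_∈_; _∉_)
  import Data.List.Membership.Propositional.Properties as ∈
  open import Data.List.Relation.Unary.All using (All; []; _∷_)
  import Data.List.Relation.Unary.All as All
  open import Data.List.Relation.Unary.AllPairs using ([]; _∷_)
  open import Data.List.Relation.Unary.Any using (here; there; any?)
  import Data.List.Relation.Unary.Any as Any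
  open import Data.List.Relation.Unary.Unique.Propositional using (Unique)
  import Data.List.Relation.Unary.Unique.Propositional.Properties as Unique
  open import Data.Nat using (ℕ; zero; suc; _+_; _≤_; _<_; z≤n; s≤s)
  open import Data.Nat.Properties hiding (_≟_; suc-injective)
  open import Data.List.Extrema ≤-totalOrder
    using (argmax; argmax-all; v≤f[argmax]⁺; argmin; argmin-all; f[argmin]≤v⁺)
  open import Data.Product using (∃; ∃-syntax; _×_; _,_; proj₁; proj₂)
  open import Data.Sum using (inj₂)
  open import Data.Vec using ([]; _∷_; here; there)
  open import Function using (_∘_)
  open import Level using (0ℓ)
  open import Relation.Binary.PropositionalEquality
  open import Relation.Nullary using (¬_; Dec; yes; no; does; ¬?)
  open import Relation.Nullary.Decidable using (_×-dec_)
  open import Relation.Unary using (Pred; Decidable)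

  private variable n : ℕ

  count : {P : Pred (Fin n) 0ℓ} → Decidable P → ℕ
  count {zero}  P? = 0
  count {suc n} P? = (if does (P? zero) then 1 else 0) + count (P? ∘ suc)

  count-mono : {P Q : Pred (Fin n) 0ℓ} (P? : Decidable P) (Q? : Decidable Q) →
    (∀ x → P x → Q x) → count P? ≤ count Q?
  count-mono {zero}  P? Q? P⊆Q = z≤n
  count-mono {suc n} P? Q? P⊆Q with P? zero | Q? zero
  ... | yes _ | yes _  = s≤s (count-mono (P? ∘ suc) (Q? ∘ suc) (P⊆Q ∘ suc))
  ... | yes p | no ¬q  = ⊥-elim (¬q (P⊆Q zero p))
  ... | no _  | yes _  = m≤n⇒m≤1+n (count-mono (P? ∘ suc) (Q? ∘ suc) (P⊆Q ∘ suc))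
  ... | no _  | no _   = count-mono (P? ∘ suc) (Q? ∘ suc) (P⊆Q ∘ suc)

  count-cong : {P Q : Pred (Fin n) 0ℓ} (P? : Decidable P) (Q? : Decidable Q) →
    (∀ x → P x → Q x) → (∀ x → Q x → P x) → count P? ≡ count Q?
  count-cong P? Q? P⊆Q Q⊆P = ≤-antisym (count-mono P? Q? P⊆Q) (count-mono Q? P? Q⊆P)

  count-≡0 : {P : Pred (Fin n) 0ℓ} (P? : Decidable P) → (∀ x → ¬ P x) → count P? ≡ 0
  count-≡0 {zero}  P? ¬P = refl
  count-≡0 {suc n} P? ¬P with P? zero
  ... | yes p = ⊥-elim (¬P zero p)
  ... | no _  = count-≡0 (P? ∘ suc) (¬P ∘ suc)

  count-pos : {P : Pred (Fin n) 0ℓ} (P? : Decidable P) {x : Fin n} → P x → 0 < count P?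
  count-pos {suc n} P? {zero}  p with P? zero
  ... | yes _ = s≤s z≤n
  ... | no ¬p = ⊥-elim (¬p p)
  count-pos {suc n} P? {suc x} p = ≤-trans (count-pos (P? ∘ suc) p) (m≤n+m _ _)

  count-witness : {P : Pred (Fin n) 0ℓ} (P? : Decidable P) → 0 < count P? → ∃ P
  count-witness {suc n} P? pos with P? zero
  ... | yes p = zero , p
  ... | no _  = let x , p = count-witness (P? ∘ suc) pos in suc x , p

  _─_ : Pred (Fin n) 0ℓ → Fin n → Pred (Fin n) 0ℓ
  (P ─ y) x = P x × x ≢ y

  _─?_ : {P : Pred (Fin n) 0ℓ} → Decidable P → (y : Fin n) → Decidable (P ─ y)
  (P? ─? y) x = P? x ×-dec ¬? (x ≟ y)

  ─?-suc : {P : Pred (Fin (suc n)) 0ℓ} (P? : Decidable P) (y : Fin n) →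
    count ((P? ∘ suc) ─? y) ≡ count ((P? ─? suc y) ∘ suc)
  ─?-suc P? y = count-cong ((P? ∘ suc) ─? y) ((P? ─? suc y) ∘ suc)
    (λ x (q , x≢y) → q , x≢y ∘ suc-injective) (λ x (q , sx≢sy) → q , sx≢sy ∘ cong suc)

  count-─ : {P : Pred (Fin n) 0ℓ} (P? : Decidable P) {y : Fin n} → P y →
    count P? ≡ suc (count (P? ─? y))
  count-─ {suc n} P? {zero} p with P? zero
  ... | no ¬p = ⊥-elim (¬p p)
  ... | yes _ = cong suc (count-cong (P? ∘ suc) ((P? ─? zero) ∘ suc) (λ x q → q , λ ()) (λ x → proj₁))
  count-─ {suc n} P? {suc y} p with P? zero
  ... | yes _ = cong suc (trans (count-─ (P? ∘ suc) p) (cong suc (─?-suc P? y)))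
  ... | no _  = trans (count-─ (P? ∘ suc) p) (cong suc (─?-suc P? y))

  count-split : {P Q : Pred (Fin n) 0ℓ} (P? : Decidable P) (Q? : Decidable Q) →
    count (λ x → P? x ×-dec Q? x) + count (λ x → P? x ×-dec ¬? (Q? x)) ≡ count P?
  count-split {zero}  P? Q? = refl
  count-split {suc n} P? Q? with P? zero | Q? zero
  ... | yes _ | yes _ = cong suc (count-split (P? ∘ suc) (Q? ∘ suc))
  ... | yes _ | no _  = trans (+-suc _ _) (cong suc (count-split (P? ∘ suc) (Q? ∘ suc)))
  ... | no _  | yes _ = count-split (P? ∘ suc) (Q? ∘ suc)
  ... | no _  | no _  = count-split (P? ∘ suc) (Q? ∘ suc)

  2≤count : {P : Pred (Fin n) 0ℓ} (P? : Decidable P) {x y : Fin n} →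
    P x → P y → x ≢ y → 2 ≤ count P?
  2≤count P? px py x≢y =
    subst (2 ≤_) (sym (count-─ P? px)) (s≤s (count-pos (P? ─? _) (py , x≢y ∘ sym)))

  3≤count : {P : Pred (Fin n) 0ℓ} (P? : Decidable P) {x y z : Fin n} →
    P x → P y → P z → x ≢ y → x ≢ z → y ≢ z → 3 ≤ count P?
  3≤count P? px py pz x≢y x≢z y≢z = subst (3 ≤_) (sym (count-─ P? px))
    (s≤s (2≤count (P? ─? _) (py , x≢y ∘ sym) (pz , x≢z ∘ sym) y≢z))

  count-< : {P Q : Pred (Fin n) 0ℓ} (P? : Decidable P) (Q? : Decidable Q) {y : Fin n} →
    (∀ x → P x → (Q ─ y) x) → Q y → count P? < count Q?
  count-< P? Q? P⊆Q─y qy =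
    subst (count P? <_) (sym (count-─ Q? qy)) (s≤s (count-mono P? (Q? ─? _) P⊆Q─y))

  another : {P : Pred (Fin n) 0ℓ} (P? : Decidable P) → 2 ≤ count P? →
    (x : Fin n) → ∃[ y ] (P y × y ≢ x)
  another P? 2≤ x with P? x
  ... | yes px = count-witness (P? ─? x) (≤-pred (subst (2 ≤_) (count-─ P? px) 2≤))
  ... | no ¬px = let y , py = count-witness P? (≤-trans (s≤s z≤n) 2≤) in y , py , λ { refl → ¬px py }

  _∉?_ : (x : Fin n) (xs : List (Fin n)) → Dec (x ∉ xs)
  x ∉? xs = ¬? (any? (x ≟_) xs)

  _∖_ : Pred (Fin n) 0ℓ → List (Fin n) → Pred (Fin n) 0ℓ
  (P ∖ xs) x = P x × x ∉ xs

  _∖?_ : {P : Pred (Fin n) 0ℓ} → Decidable P → (xs : List (Fin n)) → Decidable (P ∖ xs)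
  (P? ∖? xs) x = P? x ×-dec x ∉? xs

  count-∖ : {P : Pred (Fin n) 0ℓ} (P? : Decidable P) {xs : List (Fin n)} →
    Unique xs → All P xs → count (P? ∖? xs) + length xs ≡ count P?
  count-∖ P? {[]} [] [] =
    trans (+-identityʳ _) (count-cong (P? ∖? []) P? (λ _ → proj₁) (λ _ p → p , λ ()))
  count-∖ P? {x ∷ xs} (x∉xs ∷ uxs) (px ∷ pxs) = begin
    count (P? ∖? (x ∷ xs)) + suc (length xs)      ≡⟨ +-suc _ _ ⟩
    suc (count (P? ∖? (x ∷ xs)) + length xs)      ≡⟨ cong (λ k → suc k + length xs) removeHead ⟩
    suc (count ((P? ∖? xs) ─? x)) + length xs     ≡⟨ cong (_+ length xs) (count-─ (P? ∖? xs) (px , x∉)) ⟨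
    count (P? ∖? xs) + length xs                  ≡⟨ count-∖ P? uxs pxs ⟩
    count P?                                      ∎
    where
    open ≡-Reasoning
    x∉ : x ∉ xs
    x∉ x∈ = All.lookup x∉xs x∈ refl
    removeHead : count (P? ∖? (x ∷ xs)) ≡ count ((P? ∖? xs) ─? x)
    removeHead = count-cong (P? ∖? (x ∷ xs)) ((P? ∖? xs) ─? x)
      (λ y (py , y∉) → (py , y∉ ∘ there) , y∉ ∘ here)
      (λ { y ((py , y∉) , y≢x) → py , λ { (here y≡x) → y≢x y≡x ; (there y∈) → y∉ y∈ } })

  count≡length : {P : Pred (Fin n) 0ℓ} (P? : Decidable P) {xs : List (Fin n)} →
    Unique xs → All P xs → (∀ {x} → P x → x ∈ xs) → count P? ≡ length xs
  count≡length P? {xs} unique inP complete = begin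
    count P?                        ≡⟨ count-∖ P? unique inP ⟨
    count (P? ∖? xs) + length xs
      ≡⟨ cong (_+ length xs) (count-≡0 (P? ∖? xs) λ _ (px , x∉) → x∉ (complete px)) ⟩
    length xs                       ∎
    where open ≡-Reasoning

  enumerate : {P : Pred (Fin n) 0ℓ} → Decidable P → List (Fin n)
  enumerate {n} P? = filter P? (allFin n)

  module _ {P : Pred (Fin n) 0ℓ} (P? : Decidable P) where

    enumerate-sound : ∀ {x} → x ∈ enumerate P? → P x
    enumerate-sound x∈ = proj₂ (∈.∈-filter⁻ P? {xs = allFin n} x∈)

    enumerate-complete : ∀ {x} → P x → x ∈ enumerate P?
    enumerate-complete px = ∈.∈-filter⁺ P? (∈.∈-allFin _) px

    enumerate-unique : Unique (enumerate P?)
    enumerate-unique = Unique.filter⁺ P? (Unique.allFin⁺ n)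

    length-enumerate : length (enumerate P?) ≡ count P?
    length-enumerate = sym (count≡length P? enumerate-unique (All.tabulate enumerate-sound) enumerate-complete)

  module _ {P : Pred (Fin n) 0ℓ} (P? : Decidable P) (g : Fin n → ℕ) where

    argmaxOn : ∀ {x} → P x → ∃[ a ] (P a × ∀ b → P b → g b ≤ g a)
    argmaxOn {x} px = argmax g x (enumerate P?) , argmax-all g px (All.tabulate (enumerate-sound P?)) ,
      λ b pb → v≤f[argmax]⁺ x (enumerate P?)
                 (inj₂ (Any.map (λ { refl → ≤-refl }) (enumerate-complete P? pb)))

    argminOn : ∀ {x} → P x → ∃[ a ] (P a × ∀ b → P b → g a ≤ g b)
    argminOn {x} px = argmin g x (enumerate P?) , argmin-all g px (All.tabulate (enumerate-sound P?)) ,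
      λ b pb → f[argmin]≤v⁺ x (enumerate P?)
                 (inj₂ (Any.map (λ { refl → ≤-refl }) (enumerate-complete P? pb)))

  toSubset : {P : Pred (Fin n) 0ℓ} → Decidable P → Subset n
  toSubset {zero}  P? = []
  toSubset {suc n} P? = does (P? zero) ∷ toSubset (P? ∘ suc)

  ∈-toSubset⁺ : {P : Pred (Fin n) 0ℓ} (P? : Decidable P) {x : Fin n} → P x → x ∈ₛ toSubset P?
  ∈-toSubset⁺ P? {zero} px with P? zero
  ... | yes _ = here
  ... | no ¬p = ⊥-elim (¬p px)
  ∈-toSubset⁺ P? {suc x} px = there (∈-toSubset⁺ (P? ∘ suc) px)

  ∈-toSubset⁻ : {P : Pred (Fin n) 0ℓ} (P? : Decidable P) {x : Fin n} → x ∈ₛ toSubset P? → P x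
  ∈-toSubset⁻ P? {zero} x∈ with P? zero | x∈
  ... | yes px | _ = px
  ... | no _   | ()
  ∈-toSubset⁻ P? {suc x} (there x∈) = ∈-toSubset⁻ (P? ∘ suc) x∈

  ∣toSubset∣ : {P : Pred (Fin n) 0ℓ} (P? : Decidable P) → ∣ toSubset P? ∣ ≡ count P?
  ∣toSubset∣ {zero}  P? = refl
  ∣toSubset∣ {suc n} P? with P? zero
  ... | yes _ = cong suc (∣toSubset∣ (P? ∘ suc))
  ... | no _  = ∣toSubset∣ (P? ∘ suc)

module Arithmetic where

  open import Data.Bool using (Bool; true; false; if_then_else_; T; not)
  open import Data.Empty using (⊥-elim)
  open import Data.Nat
    using (ℕ; zero; suc; _+_; _*_; _∸_; _≤_; _<_; z≤n; s≤s; _!; _<ᵇ_; NonZero; >-nonZero; _≤?_)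
  open import Data.Nat.Properties
  open import Data.Nat.Tactic.RingSolver using (solve-∀)
  open import Data.Product using (∃-syntax; _×_; _,_)
  open import Data.Sum using (_⊎_; inj₁; inj₂)
  open import Function using (_∘_)
  open import Relation.Binary.PropositionalEquality
  open import Relation.Nullary using (yes; no)

  ∏ : (ℕ → ℕ) → ℕ → ℕ → ℕ
  ∏ f i zero    = 1
  ∏ f i (suc l) = f i * ∏ f (suc i) l

  ∏-cong : ∀ {f g} i l → (∀ j → i ≤ j → j < i + l → f j ≡ g j) → ∏ f i l ≡ ∏ g i l
  ∏-cong i zero    f≗g = refl
  ∏-cong i (suc l) f≗g = cong₂ _*_ (f≗g i ≤-refl (m<m+n i (s≤s z≤n)))
    (∏-cong (suc i) l λ j i<j j< → f≗g j (<⇒≤ i<j) (subst (j <_) (sym (+-suc i l)) j<))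

  ∏-+ : ∀ f i a b → ∏ f i (a + b) ≡ ∏ f i a * ∏ f (i + a) b
  ∏-+ f i zero    b = trans (cong (λ j → ∏ f j b) (sym (+-identityʳ i))) (sym (*-identityˡ _))
  ∏-+ f i (suc a) b = begin
    f i * ∏ f (suc i) (a + b)                   ≡⟨ cong (f i *_) (∏-+ f (suc i) a b) ⟩
    f i * (∏ f (suc i) a * ∏ f (suc i + a) b)   ≡⟨ *-assoc (f i) _ _ ⟨
    f i * ∏ f (suc i) a * ∏ f (suc i + a) b     ≡⟨ cong (λ j → f i * ∏ f (suc i) a * ∏ f j b) (+-suc i a) ⟨
    f i * ∏ f (suc i) a * ∏ f (i + suc a) b     ∎
    where open ≡-Reasoning

  ∏-falling : ∀ K i l → i + l ≡ K → ∏ (K ∸_) i l ≡ l !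
  ∏-falling K i zero    _   = refl
  ∏-falling K i (suc l) i+l≡K = cong₂ _*_
    (trans (cong (_∸ i) (sym i+l≡K)) (m+n∸m≡n i (suc l)))
    (∏-falling K (suc i) l (trans (sym (+-suc i l)) i+l≡K))

  !-mono : ∀ {m n} → m ≤ n → m ! ≤ n !
  !-mono {m} {zero}  z≤n = ≤-refl
  !-mono {m} {suc n} m≤1+n with m≤n⇒m<n∨m≡n m≤1+n
  ... | inj₂ refl      = ≤-refl
  ... | inj₁ (s≤s m≤n) = ≤-trans (!-mono m≤n) (m≤n*m (n !) (suc n))

  n!<[1+n]! : ∀ n → 1 ≤ n → n ! < suc n !
  n!<[1+n]! n 1≤n = begin-strict
    n !           ≡⟨ *-identityˡ (n !) ⟨
    1 * n !       <⟨ *-monoˡ-< (n !) {{>-nonZero (1≤n! n)}} (s≤s 1≤n) ⟩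
    suc n * n !   ∎
    where open ≤-Reasoning

  a!*b!<[a+b]! : ∀ a b → 1 ≤ a → 1 ≤ b → a ! * b ! < (a + b) !
  a!*b!<[a+b]! a (suc zero) 1≤a _ = begin-strict
    a ! * 1       ≡⟨ *-identityʳ (a !) ⟩
    a !           <⟨ n!<[1+n]! a 1≤a ⟩
    suc a !       ≡⟨ cong _! (+-comm a 1) ⟨
    (a + 1) !     ∎
    where open ≤-Reasoning
  a!*b!<[a+b]! a (suc (suc b)) 1≤a _ = begin-strict
    a ! * (suc (suc b) * suc b !)     ≡⟨ regroup (a !) (suc (suc b)) (suc b !) ⟩
    suc (suc b) * (a ! * suc b !)     <⟨ *-monoʳ-< (suc (suc b)) (a!*b!<[a+b]! a (suc b) 1≤a (s≤s z≤n)) ⟩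
    suc (suc b) * (a + suc b) !       ≤⟨ *-monoˡ-≤ ((a + suc b) !) (s≤s (m≤n+m (suc b) a)) ⟩
    suc (a + suc b) * (a + suc b) !   ≡⟨ cong _! (+-suc a (suc b)) ⟨
    (a + suc (suc b)) !               ∎
    where
    open ≤-Reasoning
    regroup : ∀ x y z → x * (y * z) ≡ y * (x * z)
    regroup = solve-∀

  [a+b+1]*a!*b!<[a+b]! : ∀ a b → 2 ≤ a → 2 ≤ b → (a + b + 1) * (a ! * b !) < (a + b) !
  [a+b+1]*a!*b!<[a+b]! a@(suc (suc x)) 2 _ _ = begin-strict
    (a + 2 + 1) * (a ! * 2)                          ≡⟨ lhs x (a !) ⟩
    (2 * x + 10) * a !
      <⟨ *-monoˡ-< (a !) {{>-nonZero (1≤n! a)}} (m<m+n (2 * x + 10) (s≤s z≤n)) ⟩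
    (2 * x + 10 + suc (suc (x * x + 5 * x))) * a !   ≡⟨ rhs x (a !) ⟩
    (2 + a) * (1 + a) * a !                          ≡⟨ *-assoc (2 + a) (1 + a) (a !) ⟩
    (2 + a) !                                        ≡⟨ cong _! (+-comm 2 a) ⟩
    (a + 2) !                                        ∎
    where
    open ≤-Reasoning
    lhs : ∀ x f → (suc (suc x) + 2 + 1) * (f * 2) ≡ (2 * x + 10) * f
    lhs = solve-∀
    rhs : ∀ x f → (2 * x + 10 + suc (suc (x * x + 5 * x))) * f ≡ (2 + suc (suc x)) * (1 + suc (suc x)) * f
    rhs = solve-∀
  [a+b+1]*a!*b!<[a+b]! a@(suc (suc x)) (suc b@(suc (suc _))) 2≤a 2≤b = *-cancelˡ-< t _ _ (begin-strict
      t * ((a + suc b + 1) * (a ! * suc b !))   ≡⟨ regroup t (a + suc b + 1) (a !) (suc b) (b !) ⟩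
      (a + suc b + 1) * suc b * (t * (a ! * b !))   <⟨ *-monoʳ-< ((a + suc b + 1) * suc b) {{nonZero}}
                                                        ([a+b+1]*a!*b!<[a+b]! a b 2≤a (s≤s (s≤s z≤n))) ⟩
      (a + suc b + 1) * suc b * (a + b) !        ≤⟨ *-monoˡ-≤ ((a + b) !) factor≤t*t ⟩
      t * t * (a + b) !                          ≡⟨ *-assoc t t ((a + b) !) ⟩
      t * (t * (a + b) !)                        ≡⟨ cong (λ x → t * (x * (a + b) !)) (+-comm (a + b) 1) ⟩
      t * (suc (a + b) !)                        ≡⟨ cong (λ x → t * x !) (+-suc a b) ⟨
      t * (a + suc b) !                          ∎)
    where
    open ≤-Reasoning
    t = a + b + 1
    regroup : ∀ t x y z w → t * (x * (y * (z * w))) ≡ x * z * (t * (y * w))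
    regroup = solve-∀
    nonZero : NonZero ((a + suc b + 1) * suc b)
    nonZero = >-nonZero (*-mono-≤ {1} {a + suc b + 1} {1} {suc b} (m≤n+m 1 (a + suc b)) (s≤s z≤n))
    factor≤t*t : (a + suc b + 1) * suc b ≤ t * t
    factor≤t*t = subst ((a + suc b + 1) * suc b ≤_) (sym (square x b)) (m≤m+n _ _)
      where
      square : ∀ x b → (2 + x + b + 1) * (2 + x + b + 1) ≡
        (2 + x + suc b + 1) * suc b + (x * x + b * x + 5 * x + b + 5)
      square = solve-∀
  [a+b+1]*a!*b!<[a+b]! (suc zero)    _ (s≤s ()) _
  [a+b+1]*a!*b!<[a+b]! (suc (suc _)) (suc zero) _ (s≤s ())

  double : ℕ → ℕ
  double zero    = zero
  double (suc p) = suc (suc (double p))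

  evenFactorial : ℕ → ℕ
  evenFactorial zero    = 1
  evenFactorial (suc p) = double (suc p) * evenFactorial p

  evenFactorial<! : ∀ p → 2 ≤ p → evenFactorial (suc p) < suc (double p) !
  evenFactorial<! (suc zero) (s≤s ())
  evenFactorial<! 2 _ = <ᵇ⇒< 48 120 _
  evenFactorial<! (suc p@(suc (suc q))) _ = begin-strict
    double (suc (suc p)) * evenFactorial (suc p)
      <⟨ *-monoʳ-< (double (suc (suc p))) (evenFactorial<! p (s≤s (s≤s z≤n))) ⟩
    double (suc (suc p)) * suc (double p) !
      ≤⟨ *-monoˡ-≤ (suc (double p) !) 2p+4≤[2p+3][2p+2] ⟩
    suc (double (suc p)) * double (suc p) * suc (double p) !
      ≡⟨ *-assoc (suc (double (suc p))) (double (suc p)) (suc (double p) !) ⟩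
    suc (double (suc p)) !                           ∎
    where
    open ≤-Reasoning
    expand : ∀ q → (3 + q) * (2 + q) ≡ (4 + q) + (q * q + 4 * q + 2)
    expand = solve-∀
    2p+4≤[2p+3][2p+2] : double (suc (suc p)) ≤ suc (double (suc p)) * double (suc p)
    2p+4≤[2p+3][2p+2] = subst (double (suc (suc p)) ≤_) (sym (expand (double p))) (m≤m+n _ _)

  Threshold : ℕ → ℕ → Set
  Threshold w K = (w ≢ 4 × K ≡ (w ∸ 1) !) ⊎ (w ≡ 4 × K ≡ 9)

  lockThreshold : ∀ {P w k} → LockRank P w k → ∃[ K ] (Threshold w K × AlphaAtLeast P k K)
  lockThreshold {w = w} (notFour , four) with w ≟ 4
  ... | yes w≡4 = 9 , inj₂ (w≡4 , refl) , four w≡4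
  ... | no w≢4  = _ , inj₁ (w≢4 , refl) , notFour w≢4

  threshold≤m!⇒w≤1+m : ∀ {w K} → Threshold w K → 3 ≤ w → ∀ m → K ≤ m ! → w ≤ suc m
  threshold≤m!⇒w≤1+m {w} threshold 3≤w m K≤m! with w ≤? suc m
  ... | yes w≤1+m = w≤1+m
  ... | no w≰1+m with threshold | 3≤w
  ...   | inj₂ (refl , refl) | _ = ⊥-elim (<⇒≱ (m!<9 (≤-pred (≤-pred (≰⇒> w≰1+m)))) K≤m!)
    where
    m!<9 : ∀ {m} → m ≤ 2 → m ! < 9
    m!<9 {m} m≤2 = ≤-<-trans (!-mono m≤2) (<ᵇ⇒< 2 9 _)
  ...   | inj₁ (_ , refl) | s≤s (s≤s (s≤s {n = v} _)) = ⊥-elim (<⇒≱ (begin-strict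
      m !             ≤⟨ !-mono (≤-pred (≤-pred (≰⇒> w≰1+m))) ⟩
      suc v !         <⟨ n!<[1+n]! (suc v) (s≤s z≤n) ⟩
      suc (suc v) !   ∎) K≤m!)
    where open ≤-Reasoning

  threshold>chainBound : ∀ {w K} → Threshold w K → ∀ c′ d → suc c′ + d ≤ w → 1 ≤ c′ → 2 ≤ d →
    2 ≤ c′ ⊎ suc c′ + d < w → (suc c′ + d) * (c′ ! * d !) < K
  threshold>chainBound {w} threshold c′ d m≤w 1≤c′ 2≤d large with threshold
  ... | inj₂ (refl , refl) with large
  ...   | inj₁ 2≤c′ = ⊥-elim (<⇒≱ (s≤s (+-mono-≤ 2≤c′ 2≤d)) m≤w)
  ...   | inj₂ m<w  = ⊥-elim (<⇒≱ m<w (s≤s (+-mono-≤ 1≤c′ 2≤d)))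
  threshold>chainBound {w} threshold c′ d m≤w 1≤c′ 2≤d large | inj₁ (_ , refl) with large
  ... | inj₁ 2≤c′ = begin-strict
    suc (c′ + d) * (c′ ! * d !)   ≡⟨ cong (_* (c′ ! * d !)) (+-comm 1 (c′ + d)) ⟩
    (c′ + d + 1) * (c′ ! * d !)   <⟨ [a+b+1]*a!*b!<[a+b]! c′ d 2≤c′ 2≤d ⟩
    (c′ + d) !                    ≤⟨ !-mono (∸-monoˡ-≤ 1 m≤w) ⟩
    (w ∸ 1) !                     ∎
    where open ≤-Reasoning
  ... | inj₂ m<w = begin-strict
    suc (c′ + d) * (c′ ! * d !)   <⟨ *-monoʳ-< (suc (c′ + d)) (a!*b!<[a+b]! c′ d 1≤c′ (<⇒≤ 2≤d)) ⟩
    suc (c′ + d) !                ≤⟨ !-mono (∸-monoˡ-≤ 1 m<w) ⟩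
    (w ∸ 1) !                     ∎
    where open ≤-Reasoning

  threshold>evenFactorial : ∀ {w K} → Threshold w K → 3 ≤ w → ∀ p → double p ≡ w → evenFactorial p < K
  threshold>evenFactorial _ () 0 refl
  threshold>evenFactorial _ (s≤s (s≤s ())) 1 refl
  threshold>evenFactorial (inj₂ (_ , refl)) _ 2 refl = <ᵇ⇒< 8 9 _
  threshold>evenFactorial (inj₁ (w≢4 , _))  _ 2 refl = ⊥-elim (w≢4 refl)
  threshold>evenFactorial (inj₁ (_ , refl)) _ (suc p@(suc (suc _))) refl = evenFactorial<! p (s≤s (s≤s z≤n))
  threshold>evenFactorial (inj₂ (() , _))   _ (suc (suc (suc _))) refl

  -- Choices for the i-th image when a largest class, of size c, is listed first among m points:
  -- anything at first, then only the rest of that class, then anything unused.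
  chainBound : ℕ → ℕ → ℕ → ℕ
  chainBound m c zero    = m
  chainBound m c (suc i) = if suc i <ᵇ c then c ∸ suc i else m ∸ suc i

  ∏-chainBound : ∀ c′ d →
    ∏ (chainBound (suc c′ + d) (suc c′)) 0 (suc c′ + d) ≡ (suc c′ + d) * (c′ ! * d !)
  ∏-chainBound c′ d = cong ((suc c′ + d) *_) (begin
    ∏ f 1 (c′ + d)                   ≡⟨ ∏-+ f 1 c′ d ⟩
    ∏ f 1 c′ * ∏ f (suc c′) d
      ≡⟨ cong₂ _*_ (∏-cong 1 c′ insideClass) (∏-cong (suc c′) d outsideClass) ⟩
    ∏ (suc c′ ∸_) 1 c′ * ∏ (suc c′ + d ∸_) (suc c′) d
      ≡⟨ cong₂ _*_ (∏-falling (suc c′) 1 c′ refl) (∏-falling (suc c′ + d) (suc c′) d refl) ⟩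
    c′ ! * d !                   ∎)
    where
    open ≡-Reasoning
    f = chainBound (suc c′ + d) (suc c′)
    insideClass : ∀ j → 1 ≤ j → j < 1 + c′ → f j ≡ suc c′ ∸ j
    insideClass (suc j) _ j<c with j <ᵇ c′ in j<ᵇc
    ... | true  = refl
    ... | false = ⊥-elim (subst T j<ᵇc (<⇒<ᵇ (≤-pred j<c)))
    outsideClass : ∀ j → suc c′ ≤ j → j < suc c′ + d → f j ≡ suc c′ + d ∸ j
    outsideClass (suc j) c≤j _ with j <ᵇ c′ in j<ᵇc
    ... | true  = ⊥-elim (<⇒≱ (<ᵇ⇒< j c′ (subst T (sym j<ᵇc) _)) (≤-pred c≤j))
    ... | false = refl

  odd : ℕ → Bool
  odd zero    = false
  odd (suc i) = not (odd i)

  odd-double : ∀ a → odd (double a) ≡ false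
  odd-double zero    = refl
  odd-double (suc a) = cong (not ∘ not) (odd-double a)

  -- Choices for the i-th image when the m points are listed pair by pair: the second point
  -- of a pair must go to the partner of the image of the first.
  pairBound : ℕ → ℕ → ℕ
  pairBound m i = if odd i then 1 else m ∸ i

  ∏-pairBound : ∀ p → ∏ (pairBound (double p)) 0 (double p) ≡ evenFactorial p
  ∏-pairBound p = go 0 p refl
    where
    double-+ : ∀ a l → double (a + l) ≡ double a + double l
    double-+ zero    l = refl
    double-+ (suc a) l = cong (suc ∘ suc) (double-+ a l)
    go : ∀ a l → a + l ≡ p → ∏ (pairBound (double p)) (double a) (double l) ≡ evenFactorial l
    go a zero    _ = refl
    go a (suc l) a+l≡p rewrite odd-double a = cong₂ _*_ remaining
      (trans (*-identityˡ _) (go (suc a) l (trans (sym (+-suc a l)) a+l≡p)))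
      where
      remaining : double p ∸ double a ≡ double (suc l)
      remaining = begin
        double p ∸ double a               ≡⟨ cong (λ q → double q ∸ double a) a+l≡p ⟨
        double (a + suc l) ∸ double a     ≡⟨ cong (_∸ double a) (double-+ a (suc l)) ⟩
        double a + double (suc l) ∸ double a   ≡⟨ m+n∸m≡n (double a) (double (suc l)) ⟩
        double (suc l)                    ∎
        where open ≡-Reasoning

  ≤-if : ∀ {k x y} b → (T b → k ≤ x) → (¬ T b → k ≤ y) → k ≤ (if b then x else y)
  ≤-if true  k≤x _   = k≤x _
  ≤-if false _   k≤y = k≤y λ ()

module ChoiceSequences where

  open Counting
  open Arithmetic using (∏)
  open import Data.Empty using (⊥-elim)
  open import Data.Fin using (Fin; _≟_)
  open import Data.List using (List; []; _∷_; length; filter; tabulate)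
  open import Data.List.Properties using (length-tabulate)
  open import Data.List.Relation.Unary.All using (All; []; _∷_)
  import Data.List.Relation.Unary.All as All
  import Data.List.Relation.Unary.All.Properties as All
  open import Data.List.Relation.Unary.AllPairs using (AllPairs; []; _∷_)
  import Data.List.Relation.Unary.AllPairs.Properties as AllPairs
  open import Data.List.Relation.Unary.Any using (Any; here; there)
  open import Data.Nat using (ℕ; zero; suc; _+_; _*_; _≤_; z≤n)
  open import Data.Nat.Properties hiding (_≟_)
  open import Data.Product using (∃-syntax; _×_; _,_; proj₁)
  open import Data.Unit using (⊤)
  open import Function using (_∘_)
  open import Level using (0ℓ)
  open import Relation.Binary.PropositionalEquality
  open import Relation.Nullary using (yes; no; ¬?)
  open import Relation.Unary using (Pred; Decidable)

  length-filter+filter¬ : ∀ {A : Set} {P : Pred A 0ℓ} (P? : Decidable P) (xs : List A) →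
    length (filter P? xs) + length (filter (¬? ∘ P?) xs) ≡ length xs
  length-filter+filter¬ P? [] = refl
  length-filter+filter¬ P? (x ∷ xs) with P? x
  ... | yes _ = cong suc (length-filter+filter¬ P? xs)
  ... | no _  = trans (+-suc _ _) (cong suc (length-filter+filter¬ P? xs))

  AllPairs-restrict : ∀ {A : Set} {P : Pred A 0ℓ} {R S : A → A → Set} →
    (∀ {x y} → P x → P y → R x y → S x y) → ∀ {xs} → All P xs → AllPairs R xs → AllPairs S xs
  AllPairs-restrict R⇒S [] [] = []
  AllPairs-restrict R⇒S (px ∷ pxs) (rx ∷ rxs) =
    All.zipWith (λ (py , r) → R⇒S px py r) (pxs , rx) ∷ AllPairs-restrict R⇒S pxs rxs

  -- Admissible Ok pre L F: going through L in order, each image under F is allowed by Ok given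
  -- the images before it (latest first), followed by pre.
  Admissible : ∀ {n} → (List (Fin n) → Pred (Fin n) 0ℓ) →
    List (Fin n) → List (Fin n) → (Fin n → Fin n) → Set
  Admissible Ok pre []      F = ⊤
  Admissible Ok pre (r ∷ L) F = Ok pre (F r) × Admissible Ok (F r ∷ pre) L F

  DiffersOn : ∀ {n} → List (Fin n) → (Fin n → Fin n) → (Fin n → Fin n) → Set
  DiffersOn L F G = Any (λ r → F r ≢ G r) L

  DistinctOn : ∀ {n K} → Pred (Fin n) 0ℓ → (Fin K → Fin n → Fin n) → Set
  DistinctOn R fs = ∀ {i j} → i ≢ j → ∃[ a ] (R a × fs i a ≢ fs j a)

  module ProductRule {n : ℕ}
    (Ok : List (Fin n) → Pred (Fin n) 0ℓ) (Ok? : ∀ pre → Decidable (Ok pre))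
    (Inv : List (Fin n) → Set) (Inv-∷ : ∀ {pre v} → Inv pre → Ok pre v → Inv (v ∷ pre))
    (bound : ℕ → ℕ) (count-Ok≤bound : ∀ pre → Inv pre → count (Ok? pre) ≤ bound (length pre)) where

    -- Split the maps by their image v of the first point: those with image v are counted on the
    -- rest of the list, the others by induction on the number of images still allowed.
    mutual
      product-rule : ∀ L pre Fs → Inv pre → All (Admissible Ok pre L) Fs → AllPairs (DiffersOn L) Fs →
        length Fs ≤ ∏ bound (length pre) (length L)
      product-rule []      pre []           _ _ _ = z≤n
      product-rule []      pre (_ ∷ [])     _ _ _ = ≤-refl
      product-rule []      pre (_ ∷ _ ∷ _)  _ _ ((() ∷ _) ∷ _)
      product-rule (r ∷ L) pre Fs inv adm diff = ≤-trans
        (fan-out r L pre inv (Ok? pre) (λ ok → ok) _ refl Fs adm diff)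
        (*-monoˡ-≤ _ (count-Ok≤bound pre inv))

      fan-out : ∀ r L pre → Inv pre →
        {Q : Pred (Fin n) 0ℓ} (Q? : Decidable Q) → (∀ {v} → Q v → Ok pre v) →
        ∀ k → count Q? ≡ k → ∀ Fs → All (λ F → Q (F r) × Admissible Ok (F r ∷ pre) L F) Fs →
        AllPairs (DiffersOn (r ∷ L)) Fs → length Fs ≤ k * ∏ bound (suc (length pre)) (length L)
      fan-out r L pre inv Q? Q⇒Ok k       _  []             _ _ = z≤n
      fan-out r L pre inv Q? Q⇒Ok zero    #Q (F ∷ _) ((q , _) ∷ _) _ =
        ⊥-elim (1+n≰n (≤-trans (count-pos Q? q) (≤-reflexive #Q)))
      fan-out r L pre inv Q? Q⇒Ok (suc k) #Q Fs@(F ∷ _) adm@((q , _) ∷ _) diff = begin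
        length Fs                                                       ≡⟨ length-filter+filter¬ agrees Fs ⟨
        length (filter agrees Fs) + length (filter (¬? ∘ agrees) Fs)    ≤⟨ +-mono-≤ #agreeing #disagreeing ⟩
        ∏ bound (suc (length pre)) (length L) + k * ∏ bound (suc (length pre)) (length L)   ∎
        where
        open ≤-Reasoning
        v = F r
        agrees = λ G → G r ≟ v
        #agreeing : length (filter agrees Fs) ≤ ∏ bound (suc (length pre)) (length L)
        #agreeing = product-rule L (v ∷ pre) (filter agrees Fs) (Inv-∷ inv (Q⇒Ok q))
          (All.map (λ { (Gr≡v , _ , a) → subst (λ u → Admissible Ok (u ∷ pre) L _) Gr≡v a }) agreesAdm)
          (AllPairs-restrict
            (λ { (Fr≡v , _) (Gr≡v , _) (here Fr≢Gr) → ⊥-elim (Fr≢Gr (trans Fr≡v (sym Gr≡v)))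
               ; _ _ (there differ) → differ })
            agreesAdm (AllPairs.filter⁺ agrees diff))
          where
          agreesAdm = All.zip (All.all-filter agrees Fs , All.filter⁺ agrees adm)
        #disagreeing : length (filter (¬? ∘ agrees) Fs) ≤ k * ∏ bound (suc (length pre)) (length L)
        #disagreeing = fan-out r L pre inv (Q? ─? v) (Q⇒Ok ∘ proj₁) k
          (suc-injective (trans (sym (count-─ Q? q)) #Q))
          (filter (¬? ∘ agrees) Fs)
          (All.map (λ { (Gr≢v , q′ , a) → (q′ , Gr≢v) , a })
            (All.zip (All.all-filter (¬? ∘ agrees) Fs , All.filter⁺ (¬? ∘ agrees) adm)))
          (AllPairs.filter⁺ (¬? ∘ agrees) diff)

    distinct-admissible≤∏ : ∀ {K} (fs : Fin K → Fin n → Fin n) L → Inv [] →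
      (∀ i → Admissible Ok [] L (fs i)) → (∀ {i j} → i ≢ j → DiffersOn L (fs i) (fs j)) →
      K ≤ ∏ bound 0 (length L)
    distinct-admissible≤∏ fs L inv adm diff = subst (_≤ _) (length-tabulate fs)
      (product-rule L [] (tabulate fs) inv (All.tabulate⁺ adm) (AllPairs.tabulate⁺ diff))

module Symmetries {n : ℕ} {R : Pred (Fin n) 0ℓ} (R? : Decidable R) where

  open Counting
  open Arithmetic
  open ChoiceSequences
  open import Data.Bool using (true; false; T; if_then_else_)
  open import Data.Empty using (⊥; ⊥-elim)
  open import Data.Fin using (Fin; _≟_; toℕ)
  open import Data.Fin.Properties using (any?; toℕ-injective)
  open import Data.List using (List; []; _∷_; length; _++_)
  open import Data.List.Membership.Propositional using (_∈_; _∉_)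
  import Data.List.Membership.Propositional.Properties as ∈
  open import Data.List.Relation.Unary.All using (All; []; _∷_)
  import Data.List.Relation.Unary.All as All
  open import Data.List.Relation.Unary.All.Properties using (All¬⇒¬Any; ¬Any⇒All¬)
  open import Data.List.Relation.Unary.AllPairs using ([]; _∷_)
  open import Data.List.Relation.Unary.Any using (here; there)
  import Data.List.Relation.Unary.Any as Any
  open import Data.List.Relation.Unary.Unique.Propositional using (Unique)
  import Data.List.Relation.Unary.Unique.Propositional.Properties as Unique
  open import Data.Nat using (ℕ; suc; _+_; _*_; _∸_; _≤_; _<_; z≤n; _!; _<ᵇ_; _<?_)
  open import Data.Nat.Properties hiding (_≟_)
  open import Data.Product using (∃; ∃-syntax; _×_; _,_; proj₁; proj₂)
  open import Data.Sum using (_⊎_; inj₁; inj₂; [_,_]′)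
  open import Data.Unit using (⊤; tt)
  open import Function using (_∘_)
  open import Level using (0ℓ)
  open import Relation.Binary using (Rel) renaming (Decidable to Decidable₂)
  open import Relation.Binary.PropositionalEquality
  open import Relation.Nullary using (¬_; yes; no; ¬?)
  open import Relation.Nullary.Decidable using (_×-dec_; _→-dec_; T?)
  open import Relation.Unary using (Pred; Decidable)

  size : ℕ
  size = count R?

  record IsEquivalenceOn (_∼_ : Rel (Fin n) 0ℓ) : Set where
    field
      reflexive : ∀ {a} → R a → a ∼ a
      symmetric : ∀ {a b} → R a → R b → a ∼ b → b ∼ a
      transitive : ∀ {a b c} → R a → R b → R c → a ∼ b → b ∼ c → a ∼ c

  record IsSymmetry (_∼_ : Rel (Fin n) 0ℓ) (F : Fin n → Fin n) : Set where
    field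
      maps      : ∀ {a} → R a → R (F a)
      injective : ∀ {a b} → F a ≡ F b → a ≡ b
      onto      : ∀ {b} → R b → ∃[ a ] (R a × F a ≡ b)
      preserves : ∀ {a b} → R a → R b → a ∼ b → F a ∼ F b
      reflects  : ∀ {a b} → R a → R b → F a ∼ F b → a ∼ b

  module Classes {_∼_ : Rel (Fin n) 0ℓ} (_∼?_ : Decidable₂ _∼_) (isEquivalence : IsEquivalenceOn _∼_) where
    open IsEquivalenceOn isEquivalence

    class : Fin n → Pred (Fin n) 0ℓ
    class a v = R v × a ∼ v

    class? : ∀ a → Decidable (class a)
    class? a v = R? v ×-dec (a ∼? v)

    -- Images are chosen along a listing of R: each is an unused point of R and, at a Linked
    -- position, it must be related to the previous image.
    module Chain (Linked : Pred ℕ 0ℓ) (Linked? : Decidable Linked) where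

      latest : List (Fin n) → Fin n → Fin n
      latest []      v = v
      latest (u ∷ _) _ = u

      Ok : List (Fin n) → Pred (Fin n) 0ℓ
      Ok pre v = (R ∖ pre) v × (Linked (length pre) → latest pre v ∼ v)

      Ok? : ∀ pre → Decidable (Ok pre)
      Ok? pre v = (R? ∖? pre) v ×-dec (Linked? (length pre) →-dec (latest pre v ∼? v))

      count-Ok≤unused : ∀ pre → Unique pre → All R pre → count (Ok? pre) ≤ size ∸ length pre
      count-Ok≤unused pre unique inR = ≤-trans (count-mono (Ok? pre) (R? ∖? pre) (λ _ → proj₁))
        (m+n≤o⇒m≤o∸n _ (≤-reflexive (count-∖ R? unique inR)))

      count-Ok≤unusedInClass : ∀ u pre → Linked (suc (length pre)) →
        count (Ok? (u ∷ pre)) ≤ count (class? u ∖? (u ∷ pre))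
      count-Ok≤unusedInClass u pre linked = count-mono (Ok? (u ∷ pre)) (class? u ∖? (u ∷ pre))
        λ v ((Rv , v∉) , link) → (Rv , link linked) , v∉

      LinkedChain : ℕ → Fin n → List (Fin n) → Set
      LinkedChain i prev []      = ⊤
      LinkedChain i prev (a ∷ L) = (Linked i → prev ∼ a) × LinkedChain (suc i) a L

      ChainOrdering : List (Fin n) → Set
      ChainOrdering []      = ⊤
      ChainOrdering (a ∷ L) = LinkedChain 1 a L

      Unused : List (Fin n) → Set
      Unused pre = Unique pre × All R pre

      Unused-∷ : ∀ {pre v} → Unused pre → Ok pre v → Unused (v ∷ pre)
      Unused-∷ {pre} (unique , inR) ((Rv , v∉) , _) = ¬Any⇒All¬ pre v∉ ∷ unique , Rv ∷ inR

      chain-admissible : ∀ {F} → IsSymmetry _∼_ F → ∀ L → Unique L → All R L →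
        ChainOrdering L → Admissible Ok [] L F
      chain-admissible F-sym [] _ _ _ = tt
      chain-admissible {F} F-sym (a ∷ L) (a∉L ∷ unique) (Ra ∷ inR) chain =
        ((maps Ra , λ ()) , λ _ → reflexive (maps Ra)) , go a [] L Ra unique inR chain (fresh a L a∉L ∷ [])
        where
        open IsSymmetry F-sym
        Fresh : List (Fin n) → Fin n → Set
        Fresh L u = ∀ {r} → r ∈ L → F r ≢ u
        fresh : ∀ a L → All (a ≢_) L → Fresh L (F a)
        fresh a L a∉L r∈L Fr≡Fa = All.lookup a∉L r∈L (sym (injective Fr≡Fa))
        go : ∀ prev pre L → R prev → Unique L → All R L → LinkedChain (suc (length pre)) prev L →
          All (Fresh L) (F prev ∷ pre) → Admissible Ok (F prev ∷ pre) L F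
        go prev pre []      _     _                _          _                 _      = tt
        go prev pre (a ∷ L) Rprev (a∉L ∷ unique) (Ra ∷ inR) (link , chain) fresh′ =
          ((maps Ra , All¬⇒¬Any (All.map (λ fr → fr (here refl)) fresh′)) , preserves Rprev Ra ∘ link) ,
          go a (F prev ∷ pre) L Ra unique inR chain
            (fresh a L a∉L ∷ All.map (λ fr {r} r∈L → fr (there r∈L)) fresh′)

    outside : Fin n → Pred (Fin n) 0ℓ
    outside a v = R v × ¬ a ∼ v

    outside? : ∀ a → Decidable (outside a)
    outside? a v = R? v ×-dec ¬? (a ∼? v)

    module Bounds {K} (fs : Fin K → Fin n → Fin n) (fs-sym : ∀ i → IsSymmetry _∼_ (fs i))
      (distinct : DistinctOn R fs) where

      differsOn : ∀ L → (∀ {a} → R a → a ∈ L) → ∀ {i j} → i ≢ j → DiffersOn L (fs i) (fs j)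
      differsOn L complete i≢j =
        let a , Ra , fsa≢ = distinct i≢j in Any.map (λ { refl → fsa≢ }) (complete Ra)

      K≤size! : K ≤ size !
      K≤size! = subst (K ≤_)
        (trans (cong (∏ (size ∸_) 0) (length-enumerate R?)) (∏-falling size 0 size refl))
        (distinct-admissible≤∏ fs L ([] , []) (λ i → chain-admissible (fs-sym i) L (enumerate-unique R?)
            (All.tabulate (enumerate-sound R?)) (unlinked L))
          (differsOn L (enumerate-complete R?)))
        where
        open Chain (λ _ → ⊥) (λ _ → no λ ())
        open ProductRule Ok Ok? Unused Unused-∷ (size ∸_)
          (λ pre (unique , inR) → count-Ok≤unused pre unique inR)
        L = enumerate R?
        unlinked : ∀ L → ChainOrdering L
        unlinked []      = tt
        unlinked (a ∷ L) = go 1 a L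
          where
          go : ∀ i prev L → LinkedChain i prev L
          go i prev []      = tt
          go i prev (b ∷ L) = (λ ()) , go (suc i) b L

      module _ (a₀ : Fin n) (Ra₀ : R a₀)
        (largest : ∀ a → R a → count (class? a) ≤ count (class? a₀)) where

        private
          c = count (class? a₀)
          open Chain (_< c) (_<? c)

          InClassOfLatest : List (Fin n) → Set
          InClassOfLatest []        = ⊤
          InClassOfLatest (u ∷ pre) = All (u ∼_) pre

          Inv : List (Fin n) → Set
          Inv pre = Unused pre × (length pre ≤ c → InClassOfLatest pre)

          Inv-∷ : ∀ {pre v} → Inv pre → Ok pre v → Inv (v ∷ pre)
          Inv-∷ {[]}      unused ok = Unused-∷ (proj₁ unused) ok , λ _ → []
          Inv-∷ {u ∷ pre} {v} (unused@(_ , Ru ∷ inR) , clustered) ok@((Rv , _) , link) =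
            Unused-∷ unused ok , λ len<c → let v∼u = symmetric Ru Rv (link len<c) in
              v∼u ∷ All.zipWith (λ (u∼w , Rw) → transitive Rv Ru Rw v∼u u∼w)
                      (clustered (<⇒≤ len<c) , inR)

          count-Ok≤chainBound : ∀ pre → Inv pre → count (Ok? pre) ≤ chainBound size c (length pre)
          count-Ok≤chainBound []        _ = count-Ok≤unused [] [] []
          count-Ok≤chainBound (u ∷ pre) ((unique , inR@(Ru ∷ _)) , clustered) =
            ≤-if (suc (length pre) <ᵇ c) (λ t → inClassBound (<ᵇ⇒< (suc (length pre)) c t))
              (λ _ → count-Ok≤unused (u ∷ pre) unique inR)
            where
            inClassBound : suc (length pre) < c → count (Ok? (u ∷ pre)) ≤ c ∸ suc (length pre)
            inClassBound len<c = begin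
              count (Ok? (u ∷ pre))                      ≤⟨ count-Ok≤unusedInClass u pre len<c ⟩
              count (class? u ∖? (u ∷ pre))
                ≤⟨ m+n≤o⇒m≤o∸n _ (≤-reflexive (count-∖ (class? u) unique inClass)) ⟩
              count (class? u) ∸ suc (length pre)        ≤⟨ ∸-monoˡ-≤ (suc (length pre)) (largest u Ru) ⟩
              c ∸ suc (length pre)                       ∎
              where
              open ≤-Reasoning
              inClass : All (class u) (u ∷ pre)
              inClass = (Ru , reflexive Ru) ∷ All.zip (All.tail inR , clustered (<⇒≤ len<c))

          L = enumerate (class? a₀) ++ enumerate (outside? a₀)

          L-complete : ∀ {a} → R a → a ∈ L
          L-complete {a} Ra with a₀ ∼? a
          ... | yes a₀∼a = ∈.∈-++⁺ˡ (enumerate-complete (class? a₀) (Ra , a₀∼a))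
          ... | no a₀≁a  = ∈.∈-++⁺ʳ _ (enumerate-complete (outside? a₀) (Ra , a₀≁a))

          L-unique : Unique L
          L-unique = Unique.++⁺ (enumerate-unique (class? a₀)) (enumerate-unique (outside? a₀))
            λ (∈class , ∈outside) →
              proj₂ (enumerate-sound (outside? a₀) ∈outside) (proj₂ (enumerate-sound (class? a₀) ∈class))

          L-inR : All R L
          L-inR = All.tabulate λ a∈L →
            [ proj₁ ∘ enumerate-sound (class? a₀) , proj₁ ∘ enumerate-sound (outside? a₀) ]′ (∈.∈-++⁻ _ a∈L)

          L-chain : ChainOrdering L
          L-chain = classFirst (enumerate (class? a₀))
            (All.tabulate (enumerate-sound (class? a₀))) (length-enumerate (class? a₀))
            where
            afterClass : ∀ i prev ys → c ≤ i → LinkedChain i prev ys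
            afterClass i prev []      _   = tt
            afterClass i prev (y ∷ ys) c≤i =
              (λ i<c → ⊥-elim (<⇒≱ i<c c≤i)) , afterClass (suc i) y ys (m≤n⇒m≤1+n c≤i)
            withinClass : ∀ i prev xs → class a₀ prev → All (class a₀) xs → c ≤ i + length xs →
              LinkedChain i prev (xs ++ enumerate (outside? a₀))
            withinClass i prev []       _ _ c≤i = afterClass i prev _ (subst (c ≤_) (+-identityʳ i) c≤i)
            withinClass i prev (x ∷ xs) (Rp , a₀∼p) ((Rx , a₀∼x) ∷ inClass) c≤ =
              (λ _ → transitive Rp Ra₀ Rx (symmetric Ra₀ Rp a₀∼p) a₀∼x) ,
              withinClass (suc i) x xs (Rx , a₀∼x) inClass (subst (c ≤_) (+-suc i (length xs)) c≤)
            classFirst : ∀ xs → All (class a₀) xs → length xs ≡ c →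
              ChainOrdering (xs ++ enumerate (outside? a₀))
            classFirst []       _ 0≡c with enumerate (outside? a₀)
            ... | []     = tt
            ... | y ∷ ys = afterClass 1 y ys (subst (_≤ 1) 0≡c z≤n)
            classFirst (x ∷ xs) (inClass ∷ inClasses) len≡c =
              withinClass 1 x xs inClass inClasses (≤-reflexive (sym len≡c))

        K≤chainBound : ∀ c′ d → count (class? a₀) ≡ suc c′ → count (outside? a₀) ≡ d →
          K ≤ (suc c′ + d) * (c′ ! * d !)
        K≤chainBound c′ d c≡ d≡ =
          subst (K ≤_) (trans (cong₂ (λ x y → ∏ (chainBound x y) 0 x) size≡ c≡) (∏-chainBound c′ d))
            (subst (λ l → K ≤ ∏ (chainBound size c) 0 l) length-L
              (distinct-admissible≤∏ fs L (([] , []) , λ _ → tt)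
                (λ i → chain-admissible (fs-sym i) L L-unique L-inR L-chain) (differsOn L L-complete)))
          where
          open ProductRule Ok Ok? Inv Inv-∷ (chainBound size c) count-Ok≤chainBound
          size≡ : size ≡ suc c′ + d
          size≡ = trans (sym (count-split R? (a₀ ∼?_))) (cong₂ _+_ c≡ d≡)
          length-L : length L ≡ size
          length-L = sym (count≡length R? L-unique L-inR L-complete)

      module _ (pairs : ∀ a → R a → count (class? a) ≡ 2) where

        private
          -- the other point of the class of a (junk value a when a has no partner)
          mate : Fin n → Fin n
          mate a with any? (class? a ─? a)
          ... | yes (b , _) = b
          ... | no _        = a

          mate-spec : ∀ {a} → R a → (class a ─ a) (mate a)
          mate-spec {a} Ra with any? (class? a ─? a)
          ... | yes (_ , spec) = spec
          ... | no none        = ⊥-elim (none (another (class? a) (≤-reflexive (sym (pairs a Ra))) a))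

          mate-R : ∀ {a} → R a → R (mate a)
          mate-R = proj₁ ∘ proj₁ ∘ mate-spec

          mate-∼ : ∀ {a} → R a → a ∼ mate a
          mate-∼ = proj₂ ∘ proj₁ ∘ mate-spec

          mate≢ : ∀ {a} → R a → mate a ≢ a
          mate≢ = proj₂ ∘ mate-spec

          mate-unique : ∀ {a u} → R a → class a u → u ≢ a → u ≡ mate a
          mate-unique {a} {u} Ra inClass u≢a with u ≟ mate a
          ... | yes u≡mate = u≡mate
          ... | no u≢mate  = ⊥-elim (<⇒≱ (subst (_< 3) (sym (pairs a Ra)) ≤-refl)
            (3≤count (class? a) (Ra , reflexive Ra) (proj₁ (mate-spec Ra)) inClass
              (mate≢ Ra ∘ sym) (u≢a ∘ sym) (u≢mate ∘ sym)))

          mate-involutive : ∀ {a} → R a → mate (mate a) ≡ a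
          mate-involutive {a} Ra =
            sym (mate-unique (mate-R Ra) (Ra , symmetric Ra (mate-R Ra) (mate-∼ Ra)) (mate≢ Ra ∘ sym))

          FirstOfPair : Pred (Fin n) 0ℓ
          FirstOfPair a = R a × toℕ a < toℕ (mate a)

          FirstOfPair? : Decidable FirstOfPair
          FirstOfPair? a = R? a ×-dec (toℕ a <? toℕ (mate a))

          pairList : List (Fin n) → List (Fin n)
          pairList []       = []
          pairList (a ∷ as) = a ∷ mate a ∷ pairList as

          ∈-pairList⁻ : ∀ {v} as → v ∈ pairList as → ∃[ a ] (a ∈ as × (v ≡ a ⊎ v ≡ mate a))
          ∈-pairList⁻ (a ∷ as) (here v≡a)         = a , here refl , inj₁ v≡a
          ∈-pairList⁻ (a ∷ as) (there (here v≡m)) = a , here refl , inj₂ v≡m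
          ∈-pairList⁻ (a ∷ as) (there (there v∈)) =
            let b , b∈ , v≡ = ∈-pairList⁻ as v∈ in b , there b∈ , v≡

          ∈-pairList⁺ : ∀ {a} as → a ∈ as → a ∈ pairList as × mate a ∈ pairList as
          ∈-pairList⁺ (b ∷ as) (here refl) = here refl , there (here refl)
          ∈-pairList⁺ (b ∷ as) (there a∈) =
            let a∈′ , m∈′ = ∈-pairList⁺ as a∈ in there (there a∈′) , there (there m∈′)

          pairList-R : ∀ as → All FirstOfPair as → All R (pairList as)
          pairList-R []       []              = []
          pairList-R (a ∷ as) ((Ra , _) ∷ areFirst) = Ra ∷ mate-R Ra ∷ pairList-R as areFirst

          pairList-unique : ∀ as → Unique as → All FirstOfPair as → Unique (pairList as)
          pairList-unique []       []             []                 = []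
          pairList-unique (a ∷ as) (a∉ ∷ unique) ((Ra , a<m) ∷ areFirst) =
            ¬Any⇒All¬ _ a∉′ ∷ ¬Any⇒All¬ _ m∉ ∷ pairList-unique as unique areFirst
            where
            a∉as : a ∉ as
            a∉as a∈ = All.lookup a∉ a∈ refl
            a∉′ : a ∉ mate a ∷ pairList as
            a∉′ (here a≡m) = mate≢ Ra (sym a≡m)
            a∉′ (there a∈) with ∈-pairList⁻ as a∈
            ... | b , b∈ , inj₁ refl  = a∉as b∈
            ... | b , b∈ , inj₂ a≡mb = <-asym a<b b<a
              where
              Rb = proj₁ (All.lookup areFirst b∈)
              b<a : toℕ b < toℕ a
              b<a = subst (λ x → toℕ b < toℕ x) (sym a≡mb) (proj₂ (All.lookup areFirst b∈))
              a<b : toℕ a < toℕ b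
              a<b = subst (λ x → toℕ a < toℕ x) (trans (cong mate a≡mb) (mate-involutive Rb)) a<m
            m∉ : mate a ∉ pairList as
            m∉ m∈ with ∈-pairList⁻ as m∈
            ... | b , b∈ , inj₁ ma≡b = <-asym a<b b<a
              where
              a<b : toℕ a < toℕ b
              a<b = subst (λ x → toℕ a < toℕ x) ma≡b a<m
              b<a : toℕ b < toℕ a
              b<a = subst (λ x → toℕ b < toℕ x) (trans (cong mate (sym ma≡b)) (mate-involutive Ra))
                      (proj₂ (All.lookup areFirst b∈))
            ... | b , b∈ , inj₂ ma≡mb = a∉as (subst (_∈ as) (sym a≡b) b∈)
              where
              a≡b : a ≡ b
              a≡b = trans (sym (mate-involutive Ra))
                      (trans (cong mate ma≡mb) (mate-involutive (proj₁ (All.lookup areFirst b∈))))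

          firsts = enumerate FirstOfPair?
          L = pairList firsts

          L-complete : ∀ {a} → R a → a ∈ L
          L-complete {a} Ra with FirstOfPair? a
          ... | yes first = proj₁ (∈-pairList⁺ firsts (enumerate-complete FirstOfPair? first))
          ... | no ¬first = subst (_∈ L) (mate-involutive Ra)
                            (proj₂ (∈-pairList⁺ firsts (enumerate-complete FirstOfPair? (mate-R Ra , m<a))))
            where
            m<a : toℕ (mate a) < toℕ (mate (mate a))
            m<a = subst (λ x → toℕ (mate a) < toℕ x) (sym (mate-involutive Ra))
              (≤∧≢⇒< (≮⇒≥ (¬first ∘ (Ra ,_))) (mate≢ Ra ∘ toℕ-injective))

          open Chain (T ∘ odd) (T? ∘ odd)

          pairList-chain : ∀ as → All R as → ChainOrdering (pairList as)
          pairList-chain []       []        = tt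
          pairList-chain (a ∷ as) (Ra ∷ rs) = (λ _ → mate-∼ Ra) , go 0 (mate a) as rs
            where
            go : ∀ k prev as → All R as → LinkedChain (double (suc k)) prev (pairList as)
            go k prev []       []        = tt
            go k prev (a ∷ as) (Ra ∷ rs) =
              (λ even → ⊥-elim (subst T (odd-double (suc k)) even)) ,
              (λ _ → mate-∼ Ra) , go (suc k) (mate a) as rs

          count-Ok≤pairBound : ∀ pre → Unused pre → count (Ok? pre) ≤ pairBound size (length pre)
          count-Ok≤pairBound []        _                 = count-Ok≤unused [] [] []
          count-Ok≤pairBound (u ∷ pre) (unique , inR@(Ru ∷ _)) =
            ≤-if (odd (suc (length pre))) (λ linked → begin
              count (Ok? (u ∷ pre))              ≤⟨ count-Ok≤unusedInClass u pre linked ⟩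
              count (class? u ∖? (u ∷ pre))
                ≤⟨ count-mono (class? u ∖? (u ∷ pre)) (class? u ─? u) (λ v (inClass , v∉) → inClass , v∉ ∘ here) ⟩
              count (class? u ─? u)
                ≡⟨ suc-injective (trans (sym (count-─ (class? u) (Ru , reflexive Ru))) (pairs u Ru)) ⟩
              1                                  ∎)
              (λ _ → count-Ok≤unused (u ∷ pre) unique inR)
            where open ≤-Reasoning

        size≡double×K≤evenFactorial : ∃[ p ] (size ≡ double p × K ≤ evenFactorial p)
        size≡double×K≤evenFactorial = length firsts , size≡ ,
          subst (K ≤_) (trans (cong (λ l → ∏ (pairBound l) 0 l) size≡) (∏-pairBound (length firsts)))
            (subst (λ l → K ≤ ∏ (pairBound size) 0 l) (trans (length-pairList firsts) (sym size≡))
              (distinct-admissible≤∏ fs L ([] , [])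
                (λ i → chain-admissible (fs-sym i) L unique inR (pairList-chain firsts firstsR))
                (differsOn L L-complete)))
          where
          open ProductRule Ok Ok? Unused Unused-∷ (pairBound size) count-Ok≤pairBound
          firstsR = All.tabulate (proj₁ ∘ enumerate-sound FirstOfPair?)
          unique = pairList-unique firsts (enumerate-unique FirstOfPair?)
            (All.tabulate (enumerate-sound FirstOfPair?))
          inR = pairList-R firsts (All.tabulate (enumerate-sound FirstOfPair?))
          length-pairList : ∀ as → length (pairList as) ≡ double (length as)
          length-pairList []       = refl
          length-pairList (a ∷ as) = cong (suc ∘ suc) (length-pairList as)
          size≡ : size ≡ double (length firsts)
          size≡ = trans (count≡length R? unique inR L-complete) (length-pairList firsts)

module InvariantEquivalences {n : ℕ} {R : Pred (Fin n) 0ℓ} (R? : Decidable R) where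

  open Counting
  open Arithmetic
  open ChoiceSequences using (DistinctOn)
  open Symmetries R?
  open import Data.Empty using (⊥; ⊥-elim)
  open import Data.Fin using (Fin; _≟_)
  open import Data.Fin.Properties using (all?; ¬∀⟶∃¬)
  open import Data.Nat using (ℕ; suc; pred; >-nonZero; _+_; _≤_; _<_; z≤n; s≤s; _≤?_; _<?_)
  open import Data.Nat.Properties hiding (_≟_)
  open import Data.Product using (∃; ∃-syntax; _×_; _,_; proj₁; proj₂)
  open import Data.Sum using (_⊎_; inj₁; inj₂)
  import Data.Sum
  open import Function using (_∘_)
  open import Level using (0ℓ)
  open import Relation.Binary using (Rel) renaming (Decidable to Decidable₂)
  open import Relation.Binary.PropositionalEquality
  open import Relation.Nullary using (¬_; yes; no)
  open import Relation.Nullary.Decidable using (_×-dec_; _⊎-dec_; _→-dec_)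
  open import Relation.Unary using (Pred; Decidable)

  module _ {_≈_ : Rel (Fin n) 0ℓ} (_≈?_ : Decidable₂ _≈_) (isEquivalence : IsEquivalenceOn _≈_)
    {K} (fs : Fin K → Fin n → Fin n) (fs-sym : ∀ i → IsSymmetry _≈_ (fs i)) (distinct : DistinctOn R fs)
    {w} (threshold : Threshold w K) (3≤w : 3 ≤ w) (size≤w : size ≤ w) where

    open IsEquivalenceOn isEquivalence
    open Classes _≈?_ isEquivalence
    open Bounds fs fs-sym distinct

    -- Take a largest class, of size c ≥ 2, with d ≥ 2 points outside it. If c ≥ 3 or R is smaller
    -- than w, listing that class first leaves too few choices; otherwise every class is a pair.
    no-singletons⇒total : (∀ {a} → R a → ∃ (class a ─ a)) → ∀ {a b} → R a → R b → a ≈ b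
    no-singletons⇒total partner {a} {b} Ra Rb with a ≈? b
    ... | yes a≈b = a≈b
    ... | no a≉b  = ⊥-elim contradiction
      where
      largest = argmaxOn R? (count ∘ class?) Ra
      a₀ = proj₁ largest
      Ra₀ = proj₁ (proj₂ largest)
      c = count (class? a₀)
      d = count (outside? a₀)

      2≤c : 2 ≤ c
      2≤c = let b₀ , inClass , b₀≢a₀ = partner Ra₀ in
        2≤count (class? a₀) (Ra₀ , reflexive Ra₀) inClass (b₀≢a₀ ∘ sym)

      outsider : ∃ (outside a₀)
      outsider with a₀ ≈? a | a₀ ≈? b
      ... | yes a₀≈a | yes a₀≈b = ⊥-elim (a≉b (transitive Ra Ra₀ Rb (symmetric Ra₀ Ra a₀≈a) a₀≈b))
      ... | no a₀≉a  | _        = a , Ra , a₀≉a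
      ... | _        | no a₀≉b  = b , Rb , a₀≉b

      2≤d : 2 ≤ d
      2≤d = withPartner outsider
        where
        withPartner : ∃ (outside a₀) → 2 ≤ d
        withPartner (z , Rz , a₀≉z) = let z′ , (Rz′ , z≈z′) , z′≢z = partner Rz in
          2≤count (outside? a₀) (Rz , a₀≉z)
            (Rz′ , λ a₀≈z′ → a₀≉z (transitive Ra₀ Rz′ Rz a₀≈z′ (symmetric Rz Rz′ z≈z′))) (z′≢z ∘ sym)

      c≡1+c′ : suc (pred c) ≡ c
      c≡1+c′ = suc-pred c {{>-nonZero (≤-trans (s≤s z≤n) 2≤c)}}

      size≡c+d : size ≡ c + d
      size≡c+d = sym (count-split R? (a₀ ≈?_))

      chainCase : 2 ≤ pred c ⊎ size < w → ⊥
      chainCase large = <⇒≱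
        (threshold>chainBound threshold (pred c) d (subst (_≤ w) size≡ size≤w) (pred-mono-≤ 2≤c) 2≤d
          (Data.Sum.map₂ (subst (_< w) size≡) large))
        (K≤chainBound a₀ Ra₀ (proj₂ (proj₂ largest)) (pred c) d (sym c≡1+c′) refl)
        where
        size≡ : size ≡ suc (pred c) + d
        size≡ = trans size≡c+d (cong (_+ d) (sym c≡1+c′))

      pairs : c ≡ 2 → ∀ a → R a → count (class? a) ≡ 2
      pairs c≡2 a Ra = ≤-antisym (≤-trans (proj₂ (proj₂ largest) a Ra) (≤-reflexive c≡2))
        (let b , inClass , b≢a = partner Ra in 2≤count (class? a) (Ra , reflexive Ra) inClass (b≢a ∘ sym))

      pairCase : c ≡ 2 → size ≡ w → ⊥
      pairCase c≡2 size≡w =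
        let p , size≡2p , K≤evenFactorial = size≡double×K≤evenFactorial (pairs c≡2) in
          <⇒≱ (threshold>evenFactorial threshold 3≤w p (trans (sym size≡2p) size≡w)) K≤evenFactorial

      contradiction : ⊥
      contradiction with 2 ≤? pred c | size <? w
      ... | yes 2≤c′ | _          = chainCase (inj₁ 2≤c′)
      ... | no _     | yes size<w = chainCase (inj₂ size<w)
      ... | no c′≱2  | no size≮w  = pairCase
        (≤-antisym (subst (_≤ 2) c≡1+c′ (s≤s (≤-pred (≰⇒> c′≱2)))) 2≤c)
        (≤-antisym size≤w (≮⇒≥ size≮w))

  module _ {_∼_ : Rel (Fin n) 0ℓ} (_∼?_ : Decidable₂ _∼_) (isEquivalence : IsEquivalenceOn _∼_) where

    open IsEquivalenceOn isEquivalence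
    open Classes _∼?_ isEquivalence using (class)

    Singleton : Pred (Fin n) 0ℓ
    Singleton a = ∀ u → R u → a ∼ u → u ≡ a

    Singleton? : Decidable Singleton
    Singleton? a = all? λ u → R? u →-dec (a ∼? u →-dec u ≟ a)

    singletons? : Decidable (λ a → R a × Singleton a)
    singletons? a = R? a ×-dec Singleton? a

    non-singleton : ∀ {x y} → R y → x ≢ y → x ∼ y → ¬ Singleton x
    non-singleton Ry x≢y x∼y single = x≢y (sym (single _ Ry x∼y))

    module _ {F : Fin n → Fin n} (F-sym : IsSymmetry _∼_ F) where
      open IsSymmetry F-sym

      Singleton-preserved : ∀ {a} → R a → Singleton a → Singleton (F a)
      Singleton-preserved Ra single u Ru Fa∼u with onto Ru
      ... | b , Rb , refl = cong F (single b Rb (reflects Ra Rb Fa∼u))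

      Singleton-reflected : ∀ {a} → R a → Singleton (F a) → Singleton a
      Singleton-reflected Ra single u Ru a∼u = injective (single (F u) (maps Ru) (preserves Ra Ru a∼u))

    non-singleton-partner : ∀ {a} → R a → ¬ Singleton a → ∃ (class a ─ a)
    non-singleton-partner {a} Ra ¬single with ¬∀⟶∃¬ n _ (λ u → R? u →-dec (a ∼? u →-dec u ≟ a)) ¬single
    ... | u , ¬closed with R? u | a ∼? u | u ≟ a
    ...   | yes Ru | yes a∼u | no u≢a = u , (Ru , a∼u) , u≢a
    ...   | no ¬Ru | _       | _      = ⊥-elim (¬closed λ Ru → ⊥-elim (¬Ru Ru))
    ...   | _      | no a≁u  | _      = ⊥-elim (¬closed λ _ a∼u → ⊥-elim (a≁u a∼u))
    ...   | _      | _       | yes u≡a = ⊥-elim (¬closed λ _ _ → u≡a)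

    -- Merging the singleton classes into one keeps the relation invariant and, unless there is
    -- exactly one singleton (which every symmetry would then fix), leaves no singleton class.
    _≈_ : Rel (Fin n) 0ℓ
    a ≈ b = a ∼ b ⊎ (Singleton a × Singleton b)

    _≈?_ : Decidable₂ _≈_
    a ≈? b = (a ∼? b) ⊎-dec (Singleton? a ×-dec Singleton? b)

    ≈-isEquivalence : IsEquivalenceOn _≈_
    ≈-isEquivalence = record { reflexive = inj₁ ∘ reflexive ; symmetric = ≈-sym ; transitive = ≈-trans }
      where
      ≈-sym : ∀ {a b} → R a → R b → a ≈ b → b ≈ a
      ≈-sym Ra Rb (inj₁ a∼b)           = inj₁ (symmetric Ra Rb a∼b)
      ≈-sym _  _  (inj₂ (single , single′)) = inj₂ (single′ , single)
      ≈-trans : ∀ {a b c} → R a → R b → R c → a ≈ b → b ≈ c → a ≈ c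
      ≈-trans Ra Rb Rc (inj₁ a∼b) (inj₁ b∼c) = inj₁ (transitive Ra Rb Rc a∼b b∼c)
      ≈-trans Ra Rb Rc (inj₁ a∼b) b≈c@(inj₂ (single-b , _)) =
        subst (_≈ _) (sym (single-b _ Ra (symmetric Ra Rb a∼b))) b≈c
      ≈-trans Ra Rb Rc a≈b@(inj₂ (_ , single-b)) (inj₁ b∼c) =
        subst (_ ≈_) (sym (single-b _ Rc b∼c)) a≈b
      ≈-trans _ _ _ (inj₂ (single-a , _)) (inj₂ (_ , single-c)) = inj₂ (single-a , single-c)

    ≈-symmetry : ∀ {F} → IsSymmetry _∼_ F → IsSymmetry _≈_ F
    ≈-symmetry F-sym = record
      { maps = maps ; injective = injective ; onto = onto
      ; preserves = λ { Ra Rb (inj₁ a∼b) → inj₁ (preserves Ra Rb a∼b)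
                      ; Ra Rb (inj₂ (sa , sb)) →
                          inj₂ (Singleton-preserved F-sym Ra sa , Singleton-preserved F-sym Rb sb) }
      ; reflects = λ { Ra Rb (inj₁ Fa∼Fb) → inj₁ (reflects Ra Rb Fa∼Fb)
                     ; Ra Rb (inj₂ (sa , sb)) →
                         inj₂ (Singleton-reflected F-sym Ra sa , Singleton-reflected F-sym Rb sb) } }
      where open IsSymmetry F-sym

    ≈-partner : count singletons? ≢ 1 → ∀ {a} → R a → ∃[ b ] ((R b × a ≈ b) × b ≢ a)
    ≈-partner #≢1 {a} Ra with Singleton? a
    ... | no ¬single =
      let b , (Rb , a∼b) , b≢a = non-singleton-partner Ra ¬single in b , (Rb , inj₁ a∼b) , b≢a
    ... | yes single =
      let b , (Rb , single′) , b≢a = another singletons? 2≤# a in b , (Rb , inj₂ (single , single′)) , b≢a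
      where
      2≤# : 2 ≤ count singletons?
      2≤# = ≤∧≢⇒< (count-pos singletons? (Ra , single)) (#≢1 ∘ sym)

    module _ (moved : ∀ {z} → R z → ∃[ F ] (IsSymmetry _∼_ F × F z ≢ z)) where

      no-unique-singleton : count singletons? ≢ 1
      no-unique-singleton #≡1 with count-witness singletons? (≤-reflexive (sym #≡1))
      ... | z , Rz , single with moved Rz
      ...   | F , F-sym , Fz≢z = <-irrefl refl (subst (2 ≤_) #≡1 (2≤count singletons? (Rz , single)
                                   (maps Rz , Singleton-preserved F-sym Rz single) (Fz≢z ∘ sym)))
        where open IsSymmetry F-sym

      module _ {K} (fs : Fin K → Fin n → Fin n) (fs-sym : ∀ i → IsSymmetry _∼_ (fs i))
        (distinct : DistinctOn R fs)
        {w} (threshold : Threshold w K) (3≤w : 3 ≤ w) (size≤w : size ≤ w) where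

        ≈-total : ∀ {a b} → R a → R b → a ≈ b
        ≈-total = no-singletons⇒total _≈?_ ≈-isEquivalence fs (≈-symmetry ∘ fs-sym) distinct
          threshold 3≤w size≤w
          (≈-partner no-unique-singleton)

        invariant-equivalence-total : ∀ {x y} → R x → R y → x ≢ y → x ∼ y →
          ∀ {a b} → R a → R b → a ∼ b
        invariant-equivalence-total {x} {y} Rx Ry x≢y x∼y {a} {b} Ra Rb with a ∼? b
        ... | yes a∼b = a∼b
        ... | no a≁b with ≈-total Ra Rb
        ...   | inj₁ a∼b = ⊥-elim (a≁b a∼b)
        ...   | inj₂ (single-a , _) with ≈-total Rx Ra
        ...     | inj₁ x∼a          = ⊥-elim (non-singleton Ry x≢y x∼y
                                        (subst Singleton (sym (single-a x Rx (symmetric Rx Ra x∼a))) single-a))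
        ...     | inj₂ (single-x , _) = ⊥-elim (non-singleton Ry x≢y x∼y single-x)

module Posets (P : FinPoset) where

  open Counting
  open ChoiceSequences using (DistinctOn)
  open Symmetries
  open InvariantEquivalences
  open Arithmetic using (Threshold; threshold≤m!⇒w≤1+m)
  open import Data.Empty using (⊥-elim)
  open import Data.Fin using (Fin; zero; suc; _≟_)
  open import Data.Fin.Properties using (any?; all?; ¬∀⟶∃¬)
  open import Data.Fin.Subset using (∣_∣) renaming (_∈_ to _∈ₛ_)
  open import Data.Nat using (zero; suc; _≤_; s≤s)
  open import Data.Nat.Properties hiding (_≟_)
  open import Data.Product using (∃; ∃-syntax; _×_; _,_; proj₁; proj₂; swap)
  open import Data.Sum using (_⊎_; inj₁; inj₂)
  open import Function using (_∘_)
  open import Level using (0ℓ)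
  open import Relation.Binary using (IsPartialOrder) renaming (Decidable to Decidable₂)
  open import Relation.Binary.PropositionalEquality
  open import Relation.Nullary using (¬_; yes; no; ¬?)
  open import Relation.Nullary.Decidable using (_×-dec_; _⊎-dec_; _→-dec_)
  open import Relation.Unary using (Pred; Decidable)

  open FinPoset P
  private module PO = IsPartialOrder isPO

  ⊏-trans : ∀ {x y z} → _⊏_ P x y → _⊏_ P y z → _⊏_ P x z
  ⊏-trans (x⊑y , x≢y) (y⊑z , _) = PO.trans x⊑y y⊑z , λ { refl → x≢y (PO.antisym x⊑y y⊑z) }

  ⊑-⊏-trans : ∀ {x y z} → x ⊑ y → _⊏_ P y z → _⊏_ P x z
  ⊑-⊏-trans x⊑y (y⊑z , y≢z) = PO.trans x⊑y y⊑z , λ { refl → y≢z (PO.antisym y⊑z x⊑y) }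

  ⊏-⊑-trans : ∀ {x y z} → _⊏_ P x y → y ⊑ z → _⊏_ P x z
  ⊏-⊑-trans (x⊑y , x≢y) y⊑z = PO.trans x⊑y y⊑z , λ { refl → x≢y (PO.antisym x⊑y y⊑z) }

  _⁻¹ : Aut P → Aut P
  Φ ⁻¹ = record
    { to = from ; from = to ; to-from = from-to ; from-to = to-from
    ; preserve = λ x y x⊑y → reflect (from x) (from y) (subst₂ _⊑_ (sym (to-from x)) (sym (to-from y)) x⊑y)
    ; reflect  = λ x y x⊑y → subst₂ _⊑_ (to-from x) (to-from y) (preserve (from x) (from y) x⊑y) }
    where open Aut Φ

  module _ (Φ : Aut P) where
    open Aut Φ

    to-injective : ∀ {x y} → to x ≡ to y → x ≡ y
    to-injective {x} {y} tx≡ty = trans (sym (from-to x)) (trans (cong from tx≡ty) (from-to y))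

    ⊏-preserve : ∀ {x y} → _⊏_ P x y → _⊏_ P (to x) (to y)
    ⊏-preserve (x⊑y , x≢y) = preserve _ _ x⊑y , x≢y ∘ to-injective

    ⊏-reflect : ∀ {x y} → _⊏_ P (to x) (to y) → _⊏_ P x y
    ⊏-reflect (tx⊑ty , tx≢ty) = reflect _ _ tx⊑ty , tx≢ty ∘ cong to

    ⊏-reflectʳ : ∀ {x y} → _⊏_ P (to x) y → _⊏_ P x (from y)
    ⊏-reflectʳ {x} {y} tx⊏y = ⊏-reflect (subst (_⊏_ P (to x)) (sym (to-from y)) tx⊏y)

    ⊏-reflectˡ : ∀ {x y} → _⊏_ P x (to y) → _⊏_ P (from x) y
    ⊏-reflectˡ {x} {y} x⊏ty = ⊏-reflect (subst (λ z → _⊏_ P z (to y)) (sym (to-from x)) x⊏ty)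

    ⋖-preserve : ∀ {x y} → _⋖_ P x y → _⋖_ P (to x) (to y)
    ⋖-preserve (x⊏y , nothingBetween) =
      ⊏-preserve x⊏y , λ (u , tx⊏u , u⊏ty) → nothingBetween (from u , ⊏-reflectʳ tx⊏u , ⊏-reflectˡ u⊏ty)

  ⋖-reflect : ∀ (Φ : Aut P) {x y} → _⋖_ P (Aut.to Φ x) (Aut.to Φ y) → _⋖_ P x y
  ⋖-reflect Φ {x} {y} c = subst₂ (_⋖_ P) (Aut.from-to Φ x) (Aut.from-to Φ y) (⋖-preserve (Φ ⁻¹) c)

  mutual
    Below-preserve : ∀ (Φ : Aut P) k {x} → Below P k x → Below P k (Aut.to Φ x)
    Below-preserve Φ (suc k) (inj₁ below) = inj₁ (Below-preserve Φ k below)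
    Below-preserve Φ (suc k) (inj₂ rank)  = inj₂ (Rank-preserve Φ k rank)

    Rank-preserve : ∀ (Φ : Aut P) k {x} → Rank P k x → Rank P k (Aut.to Φ x)
    Rank-preserve Φ k {x} (¬below , lowerBelow) =
      (λ below → ¬below (subst (Below P k) (from-to x) (Below-preserve (Φ ⁻¹) k below))) ,
      λ z z⊏tx → subst (Below P k) (to-from z) (Below-preserve Φ k (lowerBelow (from z) (⊏-reflectˡ Φ z⊏tx)))
      where open Aut Φ

  Rank-antichain : ∀ k {x y} → Rank P k x → Rank P k y → x ⊑ y → x ≡ y
  Rank-antichain k {x} {y} (¬below-x , _) (_ , lowerBelow-y) x⊑y with x ≟ y
  ... | yes x≡y = x≡y
  ... | no x≢y  = ⊥-elim (¬below-x (lowerBelow-y x (x⊑y , x≢y)))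

  antichain-count≤ : ∀ {w} → (∀ A → IsAntichain P A → ∣ A ∣ ≤ w) →
    {Q : Pred (Fin n) 0ℓ} (Q? : Decidable Q) → (∀ {x y} → Q x → Q y → x ⊑ y → x ≡ y) → count Q? ≤ w
  antichain-count≤ width Q? antichain = subst (_≤ _) (∣toSubset∣ Q?)
    (width (toSubset Q?) λ x y x∈ y∈ → antichain (∈-toSubset⁻ Q? x∈) (∈-toSubset⁻ Q? y∈))

  module _ (_⊑?_ : Decidable₂ _⊑_) where

    _⊏?_ : Decidable₂ (_⊏_ P)
    x ⊏? y = (x ⊑? y) ×-dec ¬? (x ≟ y)

    _⋖?_ : Decidable₂ (_⋖_ P)
    x ⋖? y = (x ⊏? y) ×-dec ¬? (any? λ u → (x ⊏? u) ×-dec (u ⊏? y))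

    mutual
      Below? : ∀ k → Decidable (Below P k)
      Below? zero    x = no λ ()
      Below? (suc k) x = Below? k x ⊎-dec Rank? k x

      Rank? : ∀ k → Decidable (Rank P k)
      Rank? k x = ¬? (Below? k x) ×-dec all? λ z → (z ⊏? x) →-dec Below? k z

    -- A point of C with the fewest points below it is minimal in C.
    minimal-exists : {C : Pred (Fin n) 0ℓ} (C? : Decidable C) → ∀ {x} → C x →
      ∃[ u ] (C u × ∀ v → C v → ¬ _⊏_ P v u)
    minimal-exists C? cx with argminOn C? (λ u → count (_⊏? u)) cx
    ... | u , cu , fewest = u , cu , λ v cv v⊏u → <⇒≱
      (count-< (_⊏? v) (_⊏? u) (λ w w⊏v → ⊏-trans w⊏v v⊏u , proj₂ w⊏v) v⊏u)
      (fewest v cv)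

    upper-cover-below : ∀ {a s} → _⊏_ P a s → ∃[ c ] (_⋖_ P a c × c ⊑ s)
    upper-cover-below {a} {s} a⊏s with minimal-exists (λ u → (a ⊏? u) ×-dec (u ⊑? s)) (a⊏s , PO.refl)
    ... | c , (a⊏c , c⊑s) , minimal =
      c , (a⊏c , λ (v , a⊏v , v⊏c) → minimal v (a⊏v , PO.trans (proj₁ v⊏c) c⊑s) v⊏c) , c⊑s

    SameUpperCovers? : Decidable₂ (SameUpperCovers P)
    SameUpperCovers? a b = all? λ z → ((a ⋖? z) →-dec (b ⋖? z)) ×-dec ((b ⋖? z) →-dec (a ⋖? z))

    module _ {R : Pred (Fin n) 0ℓ} (R? : Decidable R)
      (antichain : ∀ {x y} → R x → R y → x ⊑ y → x ≡ y)
      (invariant : ∀ (Φ : Aut P) {x} → R x → R (Aut.to Φ x))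
      (sameCovers : ∀ {r r′} → R r → R r′ → SameUpperCovers P r r′) where

      ⊏-transfer : ∀ {r r′ t} → R r → R r′ → _⊏_ P r t → _⊏_ P r′ t
      ⊏-transfer Rr Rr′ r⊏t with upper-cover-below r⊏t
      ... | c , r⋖c , c⊑t = ⊏-⊑-trans (proj₁ (proj₁ (sameCovers Rr Rr′ _) r⋖c)) c⊑t

      Incomparable : Pred (Fin n) 0ℓ
      Incomparable z = ∀ r → R r → ¬ z ⊑ r × ¬ r ⊑ z

      Incomparable? : Decidable Incomparable
      Incomparable? z = all? λ r → R? r →-dec (¬? (z ⊑? r) ×-dec ¬? (r ⊑? z))

      comparable-witness : ∀ {z} → ¬ Incomparable z → ∃[ r ] (R r × (z ⊑ r ⊎ r ⊑ z))
      comparable-witness {z} ¬inc with ¬∀⟶∃¬ n _ (λ r → R? r →-dec (¬? (z ⊑? r) ×-dec ¬? (r ⊑? z))) ¬inc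
      ... | r , ¬separated with R? r | z ⊑? r | r ⊑? z
      ...   | yes Rr | yes z⊑r | _     = r , Rr , inj₁ z⊑r
      ...   | yes Rr | _       | yes r⊑z = r , Rr , inj₂ r⊑z
      ...   | yes Rr | no z⋢r  | no r⋢z  = ⊥-elim (¬separated λ _ → z⋢r , r⋢z)
      ...   | no ¬Rr | _       | _       = ⊥-elim (¬separated λ Rr → ⊥-elim (¬Rr Rr))

      Incomparable-invariant : ∀ (Φ : Aut P) {z} → Incomparable z → Incomparable (Aut.to Φ z)
      Incomparable-invariant Φ {z} inc r Rr =
        (λ tz⊑r → proj₁ (inc (from r) Rr′) (reflect z (from r) (subst (to z ⊑_) (sym (to-from r)) tz⊑r))) ,
        (λ r⊑tz → proj₂ (inc (from r) Rr′) (reflect (from r) z (subst (_⊑ to z) (sym (to-from r)) r⊑tz)))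
        where
        open Aut Φ
        Rr′ = invariant (Φ ⁻¹) Rr

      incomparable-exists : Coconnected P → ∃[ r₀ ] (R r₀ × ¬ Maximal P r₀) → ∃ Incomparable
      incomparable-exists coconnected (r₀ , Rr₀ , ¬maximal) with any? Incomparable?
      ... | yes found = found
      ... | no none   = ⊥-elim (coconnected (toSubset notAbove? ,
                                             (r₀ , ∈-toSubset⁺ notAbove? (λ r₀⊏r₀ → proj₂ r₀⊏r₀ refl)) ,
                                             (s , λ s∈ → ∈-toSubset⁻ notAbove? s∈ r₀⊏s) , split))
        where
        notAbove? = λ z → ¬? (r₀ ⊏? z)
        above : ∃ (_⊏_ P r₀)
        above with any? (r₀ ⊏?_)
        ... | yes found = found
        ... | no ¬found = ⊥-elim (¬maximal ¬found)
        s = proj₁ above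
        r₀⊏s = proj₂ above
        split : ∀ b t → b ∈ₛ toSubset notAbove? → ¬ t ∈ₛ toSubset notAbove? → _⊏_ P b t
        split b t b∈ t∉ = below (comparable-witness λ inc → none (b , inc))
          where
          r₀⊏t : _⊏_ P r₀ t
          r₀⊏t with r₀ ⊏? t
          ... | yes r₀⊏t = r₀⊏t
          ... | no r₀⊏̸t = ⊥-elim (t∉ (∈-toSubset⁺ notAbove? r₀⊏̸t))
          below : ∃[ r ] (R r × (b ⊑ r ⊎ r ⊑ b)) → _⊏_ P b t
          below (r , Rr , inj₁ b⊑r) = ⊑-⊏-trans b⊑r (⊏-transfer Rr₀ Rr r₀⊏t)
          below (r , Rr , inj₂ r⊑b) with r ≟ b
          ... | yes refl = ⊏-transfer Rr₀ Rr r₀⊏t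
          ... | no r≢b   = ⊥-elim (∈-toSubset⁻ notAbove? b∈ (⊏-transfer Rr Rr₀ (r⊑b , r≢b)))

      module _ {w} (width : ∀ A → IsAntichain P A → ∣ A ∣ ≤ w) (w≤1+size : w ≤ suc (count R?)) where

        incomparables-chain : ∀ {z₁ z₂} → Incomparable z₁ → Incomparable z₂ → z₁ ⊑ z₂ ⊎ z₂ ⊑ z₁
        incomparables-chain {z₁} {z₂} inc₁ inc₂ with z₁ ⊑? z₂ | z₂ ⊑? z₁
        ... | yes z₁⊑z₂ | _         = inj₁ z₁⊑z₂
        ... | no _      | yes z₂⊑z₁ = inj₂ z₂⊑z₁
        ... | no z₁⋢z₂  | no z₂⋢z₁  = ⊥-elim (<⇒≱ (≤-trans 2+size≤ (antichain-count≤ width Q? Q-antichain)) w≤1+size)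
          where
          Q : Pred (Fin n) 0ℓ
          Q v = R v ⊎ v ≡ z₁ ⊎ v ≡ z₂
          Q? : Decidable Q
          Q? v = R? v ⊎-dec (v ≟ z₁ ⊎-dec v ≟ z₂)
          Q-antichain : ∀ {x y} → Q x → Q y → x ⊑ y → x ≡ y
          Q-antichain (inj₁ Rx)        (inj₁ Ry)        x⊑y = antichain Rx Ry x⊑y
          Q-antichain (inj₁ Rx)        (inj₂ (inj₁ refl)) x⊑y = ⊥-elim (proj₂ (inc₁ _ Rx) x⊑y)
          Q-antichain (inj₁ Rx)        (inj₂ (inj₂ refl)) x⊑y = ⊥-elim (proj₂ (inc₂ _ Rx) x⊑y)
          Q-antichain (inj₂ (inj₁ refl)) (inj₁ Ry)        x⊑y = ⊥-elim (proj₁ (inc₁ _ Ry) x⊑y)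
          Q-antichain (inj₂ (inj₂ refl)) (inj₁ Ry)        x⊑y = ⊥-elim (proj₁ (inc₂ _ Ry) x⊑y)
          Q-antichain (inj₂ (inj₁ refl)) (inj₂ (inj₁ refl)) _ = refl
          Q-antichain (inj₂ (inj₂ refl)) (inj₂ (inj₂ refl)) _ = refl
          Q-antichain (inj₂ (inj₁ refl)) (inj₂ (inj₂ refl)) x⊑y = ⊥-elim (z₁⋢z₂ x⊑y)
          Q-antichain (inj₂ (inj₂ refl)) (inj₂ (inj₁ refl)) x⊑y = ⊥-elim (z₂⋢z₁ x⊑y)
          ∉R : ∀ {z} → Incomparable z → ¬ R z
          ∉R inc Rz = proj₁ (inc _ Rz) PO.refl
          2+size≤ : suc (suc (count R?)) ≤ count Q?
          2+size≤ = begin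
            suc (suc (count R?))                 ≤⟨ s≤s (s≤s (count-mono R? ((Q? ─? z₁) ─? z₂) R⊆)) ⟩
            suc (suc (count ((Q? ─? z₁) ─? z₂)))  ≡⟨ cong suc (count-─ (Q? ─? z₁) (inj₂ (inj₂ refl) , z₁≢z₂ ∘ sym)) ⟨
            suc (count (Q? ─? z₁))               ≡⟨ count-─ Q? (inj₂ (inj₁ refl)) ⟨
            count Q?                             ∎
            where
            open ≤-Reasoning
            z₁≢z₂ : z₁ ≢ z₂
            z₁≢z₂ refl = z₁⋢z₂ PO.refl
            R⊆ : ∀ v → R v → ((Q ─ z₁) ─ z₂) v
            R⊆ v Rv = (inj₁ Rv , λ { refl → ∉R inc₁ Rv }) , λ { refl → ∉R inc₂ Rv }

        -- The points incomparable to all of R form an automorphism-invariant chain (two incomparable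
        -- ones would widen the antichain R beyond w), nonempty by coconnectedness; its least point is fixed.
        common-fixed-point : Coconnected P → ∃[ r₀ ] (R r₀ × ¬ Maximal P r₀) → ∃[ z ] (∀ Φ → Aut.to Φ z ≡ z)
        common-fixed-point coconnected nonMaximal
          with minimal-exists Incomparable? (proj₂ (incomparable-exists coconnected nonMaximal))
        ... | z₀ , inc₀ , minimal = z₀ , λ Φ → PO.antisym (to-below Φ) (least (to-inc Φ))
          where
          to-inc : ∀ Φ → Incomparable (Aut.to Φ z₀)
          to-inc Φ = Incomparable-invariant Φ inc₀
          least : ∀ {z} → Incomparable z → z₀ ⊑ z
          least {z} inc with incomparables-chain inc₀ inc | z ≟ z₀
          ... | inj₁ z₀⊑z | _       = z₀⊑z
          ... | inj₂ _    | yes refl = PO.refl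
          ... | inj₂ z⊑z₀ | no z≢z₀  = ⊥-elim (minimal z inc (z⊑z₀ , z≢z₀))
          to-below : ∀ Φ → Aut.to Φ z₀ ⊑ z₀
          to-below Φ = subst (Aut.to Φ z₀ ⊑_) (Aut.to-from Φ z₀) (Aut.preserve Φ _ _ (least (to-inc (Φ ⁻¹))))

    module _ {R : Pred (Fin n) 0ℓ} (R? : Decidable R)
      (antichain : ∀ {x y} → R x → R y → x ⊑ y → x ≡ y)
      (invariant : ∀ (Φ : Aut P) {x} → R x → R (Aut.to Φ x)) where

      SameUpperCovers-isEquivalence : IsEquivalenceOn R? (SameUpperCovers P)
      SameUpperCovers-isEquivalence = record
        { reflexive  = λ _ z → (λ c → c) , (λ c → c)
        ; symmetric  = λ _ _ same z → swap (same z)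
        ; transitive = λ _ _ _ same same′ z →
            proj₁ (same′ z) ∘ proj₁ (same z) , proj₂ (same z) ∘ proj₂ (same′ z) }

      Aut-symmetry : ∀ (Φ : Aut P) → IsSymmetry R? (SameUpperCovers P) (Aut.to Φ)
      Aut-symmetry Φ = record
        { maps      = invariant Φ
        ; injective = to-injective Φ
        ; onto      = λ {b} Rb → from b , invariant (Φ ⁻¹) Rb , to-from b
        ; preserves = λ _ _ same z →
            ⋖-to ∘ proj₁ (same (from z)) ∘ ⋖-from , ⋖-to ∘ proj₂ (same (from z)) ∘ ⋖-from
        ; reflects  = λ _ _ same z →
            ⋖-reflect Φ ∘ proj₁ (same (to z)) ∘ ⋖-preserve Φ , ⋖-reflect Φ ∘ proj₂ (same (to z)) ∘ ⋖-preserve Φ }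
        where
        open Aut Φ
        ⋖-to : ∀ {x z} → _⋖_ P x (from z) → _⋖_ P (to x) z
        ⋖-to {x} {z} x⋖ = subst (_⋖_ P (to x)) (to-from z) (⋖-preserve Φ x⋖)
        ⋖-from : ∀ {x z} → _⋖_ P (to x) z → _⋖_ P x (from z)
        ⋖-from {x} {z} tx⋖ = ⋖-reflect Φ (subst (_⋖_ P (to x)) (sym (to-from z)) tx⋖)

      sameUpperCovers⇒≡ : ∀ {w K} →
        Coconnected P → NoCommonFixedPoint P → (∀ A → IsAntichain P A → ∣ A ∣ ≤ w) →
        3 ≤ w → Threshold w K → (Φs : Fin K → Aut P) → DistinctOn R (Aut.to ∘ Φs) →
        ∃[ r₀ ] (R r₀ × ¬ Maximal P r₀) → ∀ {x y} → R x → R y → SameUpperCovers P x y → x ≡ y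
      sameUpperCovers⇒≡ coconnected noFixedPoint width 3≤w threshold Φs distinct nonMaximal {x} {y} Rx Ry same
        with x ≟ y
      ... | yes x≡y = x≡y
      ... | no x≢y  = let z , fixed = common-fixed-point R? antichain invariant allSame width w≤1+size
                                        coconnected nonMaximal
                          Φ , Φz≢z = noFixedPoint z
                      in ⊥-elim (Φz≢z (fixed Φ))
        where
        symmetries = Aut-symmetry ∘ Φs
        moved : ∀ {z} → R z → ∃[ F ] (IsSymmetry R? (SameUpperCovers P) F × F z ≢ z)
        moved {z} _ = let Φ , Φz≢z = noFixedPoint z in Aut.to Φ , Aut-symmetry Φ , Φz≢z
        size≤w : count R? ≤ _
        size≤w = antichain-count≤ width R? antichain
        allSame : ∀ {r r′} → R r → R r′ → SameUpperCovers P r r′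
        allSame = invariant-equivalence-total R? SameUpperCovers? SameUpperCovers-isEquivalence moved (Aut.to ∘ Φs)
          symmetries distinct threshold 3≤w size≤w Rx Ry x≢y same
        w≤1+size : _ ≤ suc (count R?)
        w≤1+size = threshold≤m!⇒w≤1+m threshold 3≤w (count R?)
          (Classes.Bounds.K≤size! R? SameUpperCovers? SameUpperCovers-isEquivalence (Aut.to ∘ Φs)
            symmetries distinct)

module Decidability where

  open import Data.Empty using (⊥-elim)
  open import Data.Fin using (Fin; zero; suc; _≟_)
  open import Data.Nat using (zero; suc)
  open import Function using (_∘_)
  open import Level using (0ℓ)
  open import Relation.Binary using (Rel) renaming (Decidable to Decidable₂)
  open import Relation.Binary.PropositionalEquality
  open import Relation.Nullary using (¬_; yes; no)

  ¬¬-∀-Fin : ∀ n (Q : Fin n → Set) → (∀ i → ¬ ¬ Q i) → ¬ ¬ (∀ i → Q i)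
  ¬¬-∀-Fin zero    Q ¬¬Q k = k λ ()
  ¬¬-∀-Fin (suc n) Q ¬¬Q k =
    ¬¬Q zero λ q₀ → ¬¬-∀-Fin n (Q ∘ suc) (¬¬Q ∘ suc) λ qs → k λ { zero → q₀ ; (suc i) → qs i }

  ¬¬-Decidable₂ : ∀ {n} (_~_ : Rel (Fin n) 0ℓ) → ¬ ¬ Decidable₂ _~_
  ¬¬-Decidable₂ _~_ = ¬¬-∀-Fin _ _ λ x → ¬¬-∀-Fin _ _ λ y k → k (no (k ∘ yes))

  -- The order is not assumed decidable, but an equation between points of Fin n is stable under
  -- double negation, so a decision procedure for the order may be assumed when proving one.
  ≡-from-decidable : ∀ {n} {x y : Fin n} (_~_ : Rel (Fin n) 0ℓ) → (Decidable₂ _~_ → x ≡ y) → x ≡ y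
  ≡-from-decidable {x = x} {y} _~_ f with x ≟ y
  ... | yes x≡y = x≡y
  ... | no x≢y  = ⊥-elim (¬¬-Decidable₂ _~_ (x≢y ∘ f))

module Duality where

  open import Data.Fin.Subset using (∁; ∣_∣)
  open import Data.Fin.Subset.Properties using (x∈∁p⇒x∉p; x∉∁p⇒x∈p; x∉p⇒x∈∁p; x∈p⇒x∉∁p)
  open import Data.Nat using (_≤_)
  open import Data.Product using (_,_; proj₁; proj₂)
  open import Function using (_∘_; flip)
  open import Relation.Binary using (IsPartialOrder)
  open import Relation.Binary.PropositionalEquality
  open import Relation.Nullary using (¬_)

  dual : FinPoset → FinPoset
  dual P = record { n = n ; _⊑_ = flip _⊑_ ; isPO = record
    { isPreorder = record
      { isEquivalence = PO.isEquivalence ; reflexive = PO.reflexive ∘ sym ; trans = flip PO.trans }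
    ; antisym = flip PO.antisym } }
    where
    open FinPoset P
    module PO = IsPartialOrder isPO

  module _ {P : FinPoset} where

    Aut→dual : Aut P → Aut (dual P)
    Aut→dual Φ = record { to = to ; from = from ; to-from = to-from ; from-to = from-to
      ; preserve = flip preserve ; reflect = flip reflect }
      where open Aut Φ

    dual→Aut : Aut (dual P) → Aut P
    dual→Aut Φ = record { to = to ; from = from ; to-from = to-from ; from-to = from-to
      ; preserve = flip preserve ; reflect = flip reflect }
      where open Aut Φ

    ⊏-dual : ∀ {x y} → _⊏_ P x y → _⊏_ (dual P) y x
    ⊏-dual (x⊑y , x≢y) = x⊑y , x≢y ∘ sym

    ⊏-undual : ∀ {x y} → _⊏_ (dual P) y x → _⊏_ P x y
    ⊏-undual (x⊑y , y≢x) = x⊑y , y≢x ∘ sym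

    ⋖-dual : ∀ {x y} → _⋖_ P x y → _⋖_ (dual P) y x
    ⋖-dual (x⊏y , nothingBetween) =
      ⊏-dual x⊏y , λ (u , y⊏u , u⊏x) → nothingBetween (u , ⊏-undual u⊏x , ⊏-undual y⊏u)

    ⋖-undual : ∀ {x y} → _⋖_ (dual P) y x → _⋖_ P x y
    ⋖-undual (y⊏x , nothingBetween) =
      ⊏-undual y⊏x , λ (u , x⊏u , u⊏y) → nothingBetween (u , ⊏-dual u⊏y , ⊏-dual x⊏u)

    Coconnected-dual : Coconnected P → Coconnected (dual P)
    Coconnected-dual coconnected (B , (b , b∈B) , (t , t∉B) , split) =
      coconnected (∁ B , (t , x∉p⇒x∈∁p t∉B) , (b , x∈p⇒x∉∁p b∈B) ,
        λ b′ t′ b′∈ t′∉ → ⊏-undual (split t′ b′ (x∉∁p⇒x∈p t′∉) (x∈∁p⇒x∉p b′∈)))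

    NoCommonFixedPoint-dual : NoCommonFixedPoint P → NoCommonFixedPoint (dual P)
    NoCommonFixedPoint-dual noFixedPoint z = let Φ , moved = noFixedPoint z in Aut→dual Φ , moved

    width-dual : ∀ {w} → (∀ A → IsAntichain P A → ∣ A ∣ ≤ w) → ∀ A → IsAntichain (dual P) A → ∣ A ∣ ≤ w
    width-dual width A antichain = width A λ x y x∈ y∈ x⊑y → sym (antichain y x y∈ x∈ x⊑y)

    ¬Minimal⇒¬Maximal-dual : ∀ {x} → ¬ Minimal P x → ¬ Maximal (dual P) x
    ¬Minimal⇒¬Maximal-dual ¬minimal maximal = ¬minimal λ (y , y⊏x) → maximal (y , ⊏-dual y⊏x)

    SameLowerCovers⇒SameUpperCovers-dual : ∀ {x y} → SameLowerCovers P x y → SameUpperCovers (dual P) x y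
    SameLowerCovers⇒SameUpperCovers-dual same z =
      ⋖-dual ∘ proj₁ (same z) ∘ ⋖-undual , ⋖-dual ∘ proj₂ (same z) ∘ ⋖-undual

open Arithmetic using (lockThreshold)
open ChoiceSequences using (DistinctOn)
open Posets
open Decidability
open Duality

lemma2p9 : (P : FinPoset) → (w k : ℕ) →
    Coconnected P → NoCommonFixedPoint P → Width P w → 3 ≤ w →
    LockRank P w k →
    ((∃[ x ] (Rank P k x × ¬ (Maximal P x))) →
      ∀ x y → Rank P k x → Rank P k y → SameUpperCovers P x y → x ≡ y)
    ×
    ((∃[ x ] (Rank P k x × ¬ (Minimal P x))) →
      ∀ x y → Rank P k x → Rank P k y → SameLowerCovers P x y → x ≡ y)
lemma2p9 P w k coconnected noFixedPoint (_ , width) 3≤w lock with lockThreshold lock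
... | _ , threshold , Φs , differ = upper , lower
  where
  open FinPoset P
  distinct : DistinctOn (Rank P k) (Aut.to ∘ Φs)
  distinct {i} {j} = differ i j

  upper : ∃[ x ] (Rank P k x × ¬ Maximal P x) →
    ∀ x y → Rank P k x → Rank P k y → SameUpperCovers P x y → x ≡ y
  upper nonMaximal x y Rx Ry same = ≡-from-decidable _⊑_ λ _⊑?_ →
    sameUpperCovers⇒≡ P _⊑?_ (Rank? P _⊑?_ k) (Rank-antichain P k) (λ Φ → Rank-preserve P Φ k)
      coconnected noFixedPoint width 3≤w threshold Φs distinct nonMaximal Rx Ry same

  lower : ∃[ x ] (Rank P k x × ¬ Minimal P x) →
    ∀ x y → Rank P k x → Rank P k y → SameLowerCovers P x y → x ≡ y
  lower (x₀ , Rx₀ , ¬minimal) x y Rx Ry same = ≡-from-decidable _⊑_ λ _⊑?_ →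
    sameUpperCovers⇒≡ (dual P) (flip _⊑?_) (Rank? P _⊑?_ k) (λ Rx Ry y⊑x → sym (Rank-antichain P k Ry Rx y⊑x))
      (λ Φ → Rank-preserve P (dual→Aut Φ) k)
      (Coconnected-dual {P} coconnected) (NoCommonFixedPoint-dual {P} noFixedPoint) (width-dual {P} width)
      3≤w threshold (Aut→dual ∘ Φs) distinct (x₀ , Rx₀ , ¬Minimal⇒¬Maximal-dual {P} ¬minimal)
      Rx Ry (SameLowerCovers⇒SameUpperCovers-dual {P} same)
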